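{- Let $D$ be a $(v,k,\lambda)$-design with replication number $r$. Then (1) $\displaystyle \gamma_e(D)\ge r\,\frac{r+k-\sqrt{(r-k)^2+4(r-\lambda)}}{2\lambda}$, with equality if and only if $D$ has a maximal arc of order $\frac{k-r+\sqrt{(r-k)^2+4(r-\lambda)}}{2}$. (2) If $D$ is a symmetric design, then $\displaystyle\gamma_e(D)\ge k\,\frac{k-\sqrt{k-\lambda}}{\lambda}$, with equality if and only if $D$ has a maximal arc of order $\sqrt{k-\lambda}$.
   Context: A $(v,k,\lambda)$-design is a pair $(\mathcal P,\mathcal B)$, $\mathcal B$ a collection of subsets (blocks) of a $v$-set $\mathcal P$, with every block of size $k$, every point in $r$ blocks, and any two distinct points in exactly $\lambda\ge1$ common blocks; it is symmetric if $|\mathcal B|=v$. The incidence graph $I(D)$ is the bipartite graph on $\mathcal P\cup\mathcal B$ with $P\sim B$ iff $P\in B$. An edge dominating set is a set $\Gamma$ of edges such that every edge shares a vertex with an edge of $\Gamma$; $\gamma_e(D)$ is the minimum size of an edge dominating set of $I(D)$. A maximal arc of order $n$ is a nonempty set of points $S$ such that every block meets $S$ in $0$ or $n$ points. -}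

module Defs where

open import Data.Nat using (ℕ; zero; suc; _+_; _≤_)
open import Data.Bool using (Bool; true; false; _∧_; if_then_else_)
open import Data.Fin using (Fin; zero; suc)
open import Data.Product using (Σ; _×_; _,_; ∃)
open import Data.Sum using (_⊎_)
open import Relation.Binary.PropositionalEquality using (_≡_; _≢_)
import Data.Integer as Z
open Z using (ℤ; +_; _-_; _*_)

count : ∀ {n} → (Fin n → Bool) → ℕ
count {zero} f = 0
count {suc n} f = (if f zero then 1 else 0) + count (λ i → f (suc i))

-- A (v,k,λ)-design with b blocks and replication number r.
-- Points are Fin v, blocks are Fin b (a collection, repetitions allowed),
-- inc p B ≡ true  iff  p ∈ B.
record IsDesign (v b k r lam : ℕ) (inc : Fin v → Fin b → Bool) : Set where
  field
    block-size  : ∀ B → count (λ p → inc p B) ≡ k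
    replication : ∀ p → count (λ B → inc p B) ≡ r
    balance     : ∀ p q → p ≢ q → count (λ B → inc p B ∧ inc q B) ≡ lam
    lam-pos     : 1 ≤ lam

-- A set of edges of the incidence graph I(D): a set of incident pairs (P,B).
EdgeSet : (v b : ℕ) → Set
EdgeSet v b = Fin v → Fin b → Bool

edgeCount : ∀ {v b} → EdgeSet v b → ℕ
edgeCount {zero} Γ = 0
edgeCount {suc v} Γ = count (Γ zero) + edgeCount (λ p → Γ (suc p))

IsEdgeDominatingSet : ∀ {v b} → (Fin v → Fin b → Bool) → EdgeSet v b → Set
IsEdgeDominatingSet inc Γ =
  (∀ p B → Γ p B ≡ true → inc p B ≡ true) ×
  (∀ p B → inc p B ≡ true →
     ∃ λ p′ → ∃ λ B′ → Γ p′ B′ ≡ true × (p′ ≡ p ⊎ B′ ≡ B))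

IsEdgeDominationNumber : ∀ {v b} → (Fin v → Fin b → Bool) → ℕ → Set
IsEdgeDominationNumber inc m =
  (∃ λ Γ → IsEdgeDominatingSet inc Γ × edgeCount Γ ≡ m) ×
  (∀ Γ → IsEdgeDominatingSet inc Γ → m ≤ edgeCount Γ)

IsMaximalArc : ∀ {v b} → (Fin v → Fin b → Bool) → (Fin v → Bool) → ℕ → Set
IsMaximalArc inc S n =
  (∃ λ p → S p ≡ true) ×
  (∀ B → count (λ p → S p ∧ inc p B) ≡ 0 ⊎ count (λ p → S p ∧ inc p B) ≡ n)

HasMaximalArc : ∀ {v b} → (Fin v → Fin b → Bool) → ℕ → Set
HasMaximalArc inc n = ∃ λ S → IsMaximalArc inc S n

Δ : ℕ → ℕ → ℕ → ℤ
Δ k r lam = ((+ r) - (+ k)) * ((+ r) - (+ k)) Z.+ (+ 4) * ((+ r) - (+ lam))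

{-# OPTIONS --safe #-}
-- An edge dominating set Γ of size g leaves a set Y of y ≥ v − g points uncovered, and every
-- block meeting Y is covered, so at most g blocks meet Y.  The moments Σ|Y ∩ B| = y r and
-- Σ|Y ∩ B|² = y r + y (y − 1) λ with Cauchy–Schwarz give y r² ≤ g (r + (y − 1) λ); together with
-- λ (v − 1) = r (k − 1) this forces g ≥ β = r (r + k − √Δ) / (2λ), the smaller root of
-- λ²x² − λ r (r + k) x + r² (k r + λ − r).  Equality forces y = v − g and equality in
-- Cauchy–Schwarz, so Y is a maximal arc, whose order n satisfies n² + (r − k) n = r − λ.
-- Conversely, for such an arc the points off the arc and the blocks meeting it form a biregular
-- bipartite graph with v − |Y| = β vertices on each side; a perfect matching in it (Hall) is an
-- edge dominating set of size β.  For symmetric designs r = k and the formulas simplify.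
module Submission where

open import Defs
open import Data.Nat as ℕ using (ℕ)
open import Data.Fin using (Fin)
open import Data.Bool using (Bool)

module Counting where

  import Data.Nat.Properties
  open import Algebra.Properties.Semiring.Sum Data.Nat.Properties.+-*-semiring public
    using (sum; sum-syntax; ∑-comm; ∑-distrib-+; *-distribˡ-sum; *-distribʳ-sum; sum-cong-≗)
  open import Algebra.Properties.Semiring.Sum Data.Nat.Properties.+-*-semiring
    using (sum-remove)
  open import Data.Bool using (Bool; true; false; _∧_; _∨_; not; if_then_else_)
  open import Data.Bool.Properties using (∧-identityʳ; ∧-zeroʳ; ∨-zeroʳ)
  open import Data.Fin using (Fin; zero; suc; _≟_; punchIn)
  open import Data.Fin.Properties using (punchInᵢ≢i)
  open import Data.Nat hiding (_≟_)
  open import Data.Nat.Properties hiding (_≟_)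
  open import Data.Nat.Tactic.RingSolver using (solve-∀)
  open import Data.Product using (∃; _×_; _,_; proj₂)
  open import Function using (_∘_)
  open import Relation.Binary.PropositionalEquality
  open import Relation.Nullary using (Dec; yes; does; contradiction)
  open import Relation.Nullary.Decidable using (dec-true)

  𝟙 : Bool → ℕ
  𝟙 b = if b then 1 else 0

  𝟙-∧ : ∀ a b → 𝟙 (a ∧ b) ≡ 𝟙 a * 𝟙 b
  𝟙-∧ true  b = sym (+-identityʳ (𝟙 b))
  𝟙-∧ false b = refl

  dec-true⁻¹ : ∀ {A : Set} (a? : Dec A) → does a? ≡ true → A
  dec-true⁻¹ (yes a) _ = a

  ∧-true : ∀ {a b} → a ∧ b ≡ true → a ≡ true × b ≡ true
  ∧-true {true} {true} _ = refl , refl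

  ∧-intro : ∀ {a b} → a ≡ true → b ≡ true → a ∧ b ≡ true
  ∧-intro refl refl = refl

  not-true : ∀ {a} → not a ≡ true → a ≡ false
  not-true {false} _ = refl

  ∨-introˡ : ∀ {a b} → a ≡ true → a ∨ b ≡ true
  ∨-introˡ refl = refl

  ∨-introʳ : ∀ {a b} → b ≡ true → a ∨ b ≡ true
  ∨-introʳ {a} refl = ∨-zeroʳ a

  module _ {n : ℕ} where

    infix  4 _⊆_
    infixr 7 _∩_
    infixr 6 _∪_ _∖_

    _⊆_ : (Fin n → Bool) → (Fin n → Bool) → Set
    X ⊆ Y = ∀ i → X i ≡ true → Y i ≡ true

    _∩_ _∪_ _∖_ : (Fin n → Bool) → (Fin n → Bool) → Fin n → Bool
    (X ∩ Y) i = X i ∧ Y i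
    (X ∪ Y) i = X i ∨ Y i
    (X ∖ Y) i = X i ∧ not (Y i)

    ∁ : (Fin n → Bool) → Fin n → Bool
    ∁ X i = not (X i)

    ⁅_⁆ : Fin n → Fin n → Bool
    ⁅ i ⁆ j = does (j ≟ i)

    nonempty : (Fin n → Bool) → Bool
    nonempty X = does (0 <? count X)

  count≡∑ : ∀ {n} (X : Fin n → Bool) → count X ≡ ∑[ i < n ] 𝟙 (X i)
  count≡∑ {zero}  X = refl
  count≡∑ {suc n} X = cong (𝟙 (X zero) +_) (count≡∑ (X ∘ suc))

  count-cong : ∀ {n} {X Y : Fin n → Bool} → (∀ i → X i ≡ Y i) → count X ≡ count Y
  count-cong {zero}  X≗Y = refl
  count-cong {suc n} X≗Y = cong₂ _+_ (cong 𝟙 (X≗Y zero)) (count-cong (X≗Y ∘ suc))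

  ∑-count-comm : ∀ {m n} (R : Fin m → Fin n → Bool) →
    ∑[ i < m ] count (R i) ≡ ∑[ j < n ] count (λ i → R i j)
  ∑-count-comm {m} {n} R = begin
    ∑[ i < m ] count (R i)                 ≡⟨ sum-cong-≗ (count≡∑ ∘ R) ⟩
    ∑[ i < m ] ∑[ j < n ] 𝟙 (R i j)        ≡⟨ ∑-comm (λ i j → 𝟙 (R i j)) ⟩
    ∑[ j < n ] ∑[ i < m ] 𝟙 (R i j)        ≡⟨ sum-cong-≗ (λ j → count≡∑ (λ i → R i j)) ⟨
    ∑[ j < n ] count (λ i → R i j)         ∎
    where open ≡-Reasoning

  ∑-const : ∀ n c → ∑[ i < n ] c ≡ n * c
  ∑-const zero    c = refl
  ∑-const (suc n) c = cong (c +_) (∑-const n c)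

  ∑-mono-≤ : ∀ {n} {f g : Fin n → ℕ} → (∀ i → f i ≤ g i) → sum f ≤ sum g
  ∑-mono-≤ {zero}  f≤g = z≤n
  ∑-mono-≤ {suc n} f≤g = +-mono-≤ (f≤g zero) (∑-mono-≤ (f≤g ∘ suc))

  ∑-mono-≤-≡⇒≗ : ∀ {n} {f g : Fin n → ℕ} → (∀ i → f i ≤ g i) → sum f ≡ sum g → ∀ i → f i ≡ g i
  ∑-mono-≤-≡⇒≗ {suc n} {f} {g} f≤g ∑f≡∑g = λ where
      zero    → f₀≡g₀
      (suc i) → ∑-mono-≤-≡⇒≗ (f≤g ∘ suc) (+-cancelˡ-≡ (f zero) _ _ (trans ∑f≡∑g (cong (_+ _) (sym f₀≡g₀)))) i
    where
    f₀≡g₀ : f zero ≡ g zero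
    f₀≡g₀ = ≤-antisym (f≤g zero) (+-cancelʳ-≤ (sum (g ∘ suc)) (g zero) (f zero) (begin
      g zero + sum (g ∘ suc) ≡⟨ ∑f≡∑g ⟨
      f zero + sum (f ∘ suc) ≤⟨ +-monoʳ-≤ (f zero) (∑-mono-≤ (f≤g ∘ suc)) ⟩
      f zero + sum (g ∘ suc) ∎))
      where open ≤-Reasoning

  ∑-except : ∀ {n} {f g : Fin n → ℕ} (i : Fin n) → (∀ j → j ≢ i → f j ≡ g j) →
    sum f + g i ≡ sum g + f i
  ∑-except {suc n} {f} {g} i f≗g = begin
    sum f + g i                        ≡⟨ cong (_+ g i) (sum-remove f) ⟩
    f i + sum (f ∘ punchIn i) + g i    ≡⟨ cong (λ s → f i + s + g i) (sum-cong-≗ (λ j → f≗g _ (punchInᵢ≢i i j))) ⟩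
    f i + sum (g ∘ punchIn i) + g i    ≡⟨ swap (f i) (sum (g ∘ punchIn i)) (g i) ⟩
    g i + sum (g ∘ punchIn i) + f i    ≡⟨ cong (_+ f i) (sum-remove g) ⟨
    sum g + f i                        ∎
    where
    open ≡-Reasoning
    swap : ∀ a s c → a + s + c ≡ c + s + a
    swap = solve-∀

  𝟙-mono : ∀ {a b} → (a ≡ true → b ≡ true) → 𝟙 a ≤ 𝟙 b
  𝟙-mono {false} a⇒b = z≤n
  𝟙-mono {true}  a⇒b rewrite a⇒b refl = ≤-refl

  count-mono : ∀ {n} {X Y : Fin n → Bool} → X ⊆ Y → count X ≤ count Y
  count-mono {n} {X} {Y} X⊆Y = begin
    count X               ≡⟨ count≡∑ X ⟩
    ∑[ i < n ] 𝟙 (X i)    ≤⟨ ∑-mono-≤ (λ i → 𝟙-mono (X⊆Y i)) ⟩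
    ∑[ i < n ] 𝟙 (Y i)    ≡⟨ count≡∑ Y ⟨
    count Y               ∎
    where open ≤-Reasoning

  count-+ : ∀ {n} {X Y Z : Fin n → Bool} → (∀ i → 𝟙 (X i) ≡ 𝟙 (Y i) + 𝟙 (Z i)) →
    count X ≡ count Y + count Z
  count-+ {n} {X} {Y} {Z} pointwise = begin
    count X                                    ≡⟨ count≡∑ X ⟩
    ∑[ i < n ] 𝟙 (X i)                         ≡⟨ sum-cong-≗ pointwise ⟩
    ∑[ i < n ] (𝟙 (Y i) + 𝟙 (Z i))             ≡⟨ ∑-distrib-+ (𝟙 ∘ Y) (𝟙 ∘ Z) ⟩
    ∑[ i < n ] 𝟙 (Y i) + ∑[ i < n ] 𝟙 (Z i)    ≡⟨ cong₂ _+_ (count≡∑ Y) (count≡∑ Z) ⟨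
    count Y + count Z                          ∎
    where open ≡-Reasoning

  count-∩-∖ : ∀ {n} (X Y : Fin n → Bool) → count X ≡ count (X ∩ Y) + count (X ∖ Y)
  count-∩-∖ X Y = count-+ (λ i → split (X i) (Y i))
    where
    split : ∀ x y → 𝟙 x ≡ 𝟙 (x ∧ y) + 𝟙 (x ∧ not y)
    split true  true  = refl
    split true  false = refl
    split false y     = refl

  count-∪-disjoint : ∀ {n} {X Y : Fin n → Bool} → (∀ i → X i ≡ true → Y i ≡ false) →
    count (X ∪ Y) ≡ count X + count Y
  count-∪-disjoint {X = X} {Y} disjoint = count-+ (λ i → split (X i) (Y i) (disjoint i))
    where
    split : ∀ x y → (x ≡ true → y ≡ false) → 𝟙 (x ∨ y) ≡ 𝟙 x + 𝟙 y
    split true  true  x⇒¬y = contradiction (x⇒¬y refl) λ ()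
    split true  false x⇒¬y = refl
    split false y     x⇒¬y = refl

  count-full : ∀ n → count {n} (λ _ → true) ≡ n
  count-full zero    = refl
  count-full (suc n) = cong suc (count-full n)

  count-∁ : ∀ {n} (X : Fin n → Bool) → count X + count (∁ X) ≡ n
  count-∁ {n} X = trans (sym (count-∩-∖ (λ _ → true) X)) (count-full n)

  ⊆∪⇒count≤+ : ∀ {n} {X Y Z : Fin n → Bool} → X ⊆ Y ∪ Z → count X ≤ count Y + count Z
  ⊆∪⇒count≤+ {X = X} {Y} {Z} X⊆Y∪Z = begin
    count X                        ≡⟨ count-∩-∖ X Y ⟩
    count (X ∩ Y) + count (X ∖ Y)  ≤⟨ +-mono-≤ (count-mono ∩⊆Y) (count-mono ∖⊆Z) ⟩
    count Y + count Z              ∎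
    where
    open ≤-Reasoning
    ∩⊆Y : X ∩ Y ⊆ Y
    ∩⊆Y i X∧Y = proj₂ (∧-true X∧Y)
    ∖⊆Z : X ∖ Y ⊆ Z
    ∖⊆Z i X∧¬Y with X i | Y i | X⊆Y∪Z i
    ∖⊆Z i _  | true  | false | X⇒Y∨Z = X⇒Y∨Z refl
    ∖⊆Z i () | true  | true  | _
    ∖⊆Z i () | false | _     | _

  ∈⇒count>0 : ∀ {n} (X : Fin n → Bool) i → X i ≡ true → 0 < count X
  ∈⇒count>0 X zero    Xi rewrite Xi = s≤s z≤n
  ∈⇒count>0 X (suc i) Xi = ≤-trans (∈⇒count>0 (X ∘ suc) i Xi) (m≤n+m _ (𝟙 (X zero)))

  count>0⇒∃ : ∀ {n} (X : Fin n → Bool) → 0 < count X → ∃ λ i → X i ≡ true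
  count>0⇒∃ {suc n} X count>0 with X zero in X₀
  ... | true  = zero , X₀
  ... | false = let i , Xi = count>0⇒∃ (X ∘ suc) count>0 in suc i , Xi

  ∉⇒count≡0 : ∀ {n} (X : Fin n → Bool) → (∀ i → X i ≡ false) → count X ≡ 0
  ∉⇒count≡0 {zero}  X ∉X = refl
  ∉⇒count≡0 {suc n} X ∉X rewrite ∉X zero = ∉⇒count≡0 (X ∘ suc) (∉X ∘ suc)

  count≡0⇒∉ : ∀ {n} (X : Fin n → Bool) → count X ≡ 0 → ∀ i → X i ≡ false
  count≡0⇒∉ X count≡0 i with X i in Xi
  ... | false = refl
  ... | true  = contradiction count≡0 (>⇒≢ (∈⇒count>0 X i Xi))

  count-∧ˡ : ∀ {n} a (X : Fin n → Bool) → count (λ i → a ∧ X i) ≡ 𝟙 a * count X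
  count-∧ˡ true  X = sym (+-identityʳ (count X))
  count-∧ˡ false X = ∉⇒count≡0 (λ i → false ∧ X i) (λ _ → refl)

  count-⁅⁆ : ∀ {n} (i : Fin n) → count ⁅ i ⁆ ≡ 1
  count-⁅⁆ {suc n} zero = cong suc (∉⇒count≡0 {n} (⁅ zero ⁆ ∘ suc) (λ _ → refl))
  count-⁅⁆ {suc n} (suc i) = count-⁅⁆ i

  ∈⁅⁆⇒≡ : ∀ {n} {i j : Fin n} → ⁅ i ⁆ j ≡ true → j ≡ i
  ∈⁅⁆⇒≡ {i = i} {j} = dec-true⁻¹ (j ≟ i)

  nonempty-intro : ∀ {n} (X : Fin n → Bool) i → X i ≡ true → nonempty X ≡ true
  nonempty-intro X i Xi = dec-true (0 <? count X) (∈⇒count>0 X i Xi)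

  nonempty-elim : ∀ {n} (X : Fin n → Bool) → nonempty X ≡ true → ∃ λ i → X i ≡ true
  nonempty-elim X ne = count>0⇒∃ X (dec-true⁻¹ (0 <? count X) ne)

  nonempty⇒count>0 : ∀ {n} (X : Fin n → Bool) → nonempty X ≡ true → 0 < count X
  nonempty⇒count>0 X = dec-true⁻¹ (0 <? count X)

  empty⇒∉ : ∀ {n} (X : Fin n → Bool) → nonempty X ≡ false → ∀ i → X i ≡ false
  empty⇒∉ X empty i with X i in Xi
  ... | false = refl
  ... | true  = contradiction (trans (sym (nonempty-intro X i Xi)) empty) λ ()

  𝟙-nonempty≤count : ∀ {n} (X : Fin n → Bool) → 𝟙 (nonempty X) ≤ count X
  𝟙-nonempty≤count X with nonempty X in ne
  ... | true  = dec-true⁻¹ (0 <? count X) ne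
  ... | false = z≤n

  nonempty-cong : ∀ {n} {X Y : Fin n → Bool} → (∀ i → X i ≡ Y i) → nonempty X ≡ nonempty Y
  nonempty-cong X≗Y = cong (λ c → does (0 <? c)) (count-cong X≗Y)

  ⊆⇒∩≗ : ∀ {n} {W X : Fin n → Bool} → W ⊆ X → ∀ i → (X ∩ W) i ≡ W i
  ⊆⇒∩≗ {W = W} {X} W⊆X i with W i in Wi
  ... | true  = trans (cong (_∧ true) (W⊆X i Wi)) refl
  ... | false = ∧-zeroʳ (X i)

  ⊆⇒∪∖≗ : ∀ {n} {W X : Fin n → Bool} → W ⊆ X → ∀ i → (W ∪ (X ∖ W)) i ≡ X i
  ⊆⇒∪∖≗ {W = W} {X} W⊆X i with W i in Wi
  ... | true  = sym (W⊆X i Wi)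
  ... | false = ∧-identityʳ (X i)

  ∈⇒⁅⁆⊆ : ∀ {n} (X : Fin n → Bool) i → X i ≡ true → ⁅ i ⁆ ⊆ X
  ∈⇒⁅⁆⊆ X i Xi j j≡i = subst (λ k → X k ≡ true) (sym (∈⁅⁆⇒≡ {i = i} j≡i)) Xi

  count-∖-⊆ : ∀ {n} {W X : Fin n → Bool} → W ⊆ X → count W + count (X ∖ W) ≡ count X
  count-∖-⊆ {W = W} {X} W⊆X = trans (cong (_+ count (X ∖ W)) (sym (count-cong (⊆⇒∩≗ W⊆X)))) (sym (count-∩-∖ X W))

  ∈⇒count∖⁅⁆<count : ∀ {n} (X : Fin n → Bool) i → X i ≡ true → count (X ∖ ⁅ i ⁆) < count X
  ∈⇒count∖⁅⁆<count X i Xi = begin-strict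
    count (X ∖ ⁅ i ⁆)                  <⟨ n<1+n _ ⟩
    suc (count (X ∖ ⁅ i ⁆))            ≡⟨ cong (_+ count (X ∖ ⁅ i ⁆)) (count-⁅⁆ i) ⟨
    count ⁅ i ⁆ + count (X ∖ ⁅ i ⁆)    ≡⟨ count-∖-⊆ (∈⇒⁅⁆⊆ X i Xi) ⟩
    count X                            ∎
    where open ≤-Reasoning

  ∖-disjoint : ∀ {n} {W X : Fin n → Bool} i → W i ≡ true → (X ∖ W) i ≡ false
  ∖-disjoint {X = X} i Wi rewrite Wi = ∧-zeroʳ (X i)

  distinct-points : ∀ {n} → 2 ≤ n → ∃ λ (i : Fin n) → ∃ λ j → i ≢ j
  distinct-points (s≤s (s≤s z≤n)) = zero , suc zero , λ ()

  edgeCount≡∑ : ∀ {m n} (Γ : Fin m → Fin n → Bool) → edgeCount Γ ≡ ∑[ p < m ] count (Γ p)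
  edgeCount≡∑ {zero}  Γ = refl
  edgeCount≡∑ {suc m} Γ = cong (count (Γ zero) +_) (edgeCount≡∑ (Γ ∘ suc))

module Hall where

  open Counting
  open import Data.Bool using (Bool; true; false; _∧_; _∨_; not; _≟_)
  open import Data.Bool.Properties using (∨-identityʳ; ∧-comm; ¬-not)
  open import Data.Fin using (Fin)
  open import Data.Fin.Subset.Properties using (anySubset?)
  open import Data.Nat hiding (_≟_)
  open import Data.Nat.Properties hiding (_≟_)
  open import Data.Product using (∃; _×_; _,_; proj₁; proj₂)
  open import Data.Vec using (lookup; tabulate)
  open import Data.Vec.Properties using (lookup∘tabulate)
  open import Function using (_∘_)
  open import Relation.Binary.PropositionalEquality
  open import Relation.Nullary using (Dec; yes; no; ¬_; contradiction)
  open import Relation.Nullary.Decidable using (_×-dec_; map′)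

  module _ {v b : ℕ} where

    N : (Fin v → Fin b → Bool) → (Fin v → Bool) → Fin b → Bool
    N G X B = nonempty (λ p → X p ∧ G p B)

    HallCondition : (Fin v → Fin b → Bool) → (Fin v → Bool) → Set
    HallCondition G X = ∀ U → U ⊆ X → count U ≤ count (N G U)

    record IsMatching (G : Fin v → Fin b → Bool) (X : Fin v → Bool)
                      (M : Fin v → Fin b → Bool) : Set where
      field
        edge   : ∀ p B → M p B ≡ true → G p B ≡ true
        row    : ∀ p → count (M p) ≡ 𝟙 (X p)
        column : ∀ B → count (λ p → M p B) ≤ 1

      unmatched : ∀ p → X p ≡ false → ∀ B → M p B ≡ false
      unmatched p Xp≡false = count≡0⇒∉ (M p) (trans (row p) (cong 𝟙 Xp≡false))

      matched : ∀ p B → M p B ≡ true → X p ≡ true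
      matched p B Mp with X p in Xp
      ... | true  = refl
      ... | false = contradiction (trans (sym Mp) (unmatched p Xp B)) λ ()

    open IsMatching

    N-intro : ∀ G X p B → X p ≡ true → G p B ≡ true → N G X B ≡ true
    N-intro G X p B Xp Gp = nonempty-intro _ p (∧-intro Xp Gp)

    N-elim : ∀ G X B → N G X B ≡ true → ∃ λ p → X p ≡ true × G p B ≡ true
    N-elim G X B NB = let p , Xp∧Gp = nonempty-elim _ NB in p , ∧-true Xp∧Gp

    empty-matching : ∀ {G X} → (∀ p → X p ≡ false) → IsMatching G X (λ _ _ → false)
    empty-matching {X = X} ∉X = record
      { edge   = λ _ _ ()
      ; row    = λ p → trans (∉⇒count≡0 {b} (λ _ → false) (λ _ → refl)) (cong 𝟙 (sym (∉X p)))
      ; column = λ B → ≤-trans (≤-reflexive (∉⇒count≡0 {v} (λ _ → false) (λ _ → refl))) z≤n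
      }

    single-matching : ∀ {G p₀ B₀} → G p₀ B₀ ≡ true →
      IsMatching G ⁅ p₀ ⁆ (λ p B → ⁅ p₀ ⁆ p ∧ ⁅ B₀ ⁆ B)
    single-matching {G} {p₀} {B₀} Gp₀B₀ = record { edge = edge₀ ; row = row₀ ; column = column₀ }
      where
      edge₀ : ∀ p B → ⁅ p₀ ⁆ p ∧ ⁅ B₀ ⁆ B ≡ true → G p B ≡ true
      edge₀ p B p₀B₀ with ∧-true {⁅ p₀ ⁆ p} p₀B₀
      ... | p≡p₀ , B≡B₀ =
        subst₂ (λ p B → G p B ≡ true) (sym (∈⁅⁆⇒≡ {i = p₀} p≡p₀)) (sym (∈⁅⁆⇒≡ {i = B₀} B≡B₀))
          Gp₀B₀
      row₀ : ∀ p → count (λ B → ⁅ p₀ ⁆ p ∧ ⁅ B₀ ⁆ B) ≡ 𝟙 (⁅ p₀ ⁆ p)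
      row₀ p = trans (count-∧ˡ (⁅ p₀ ⁆ p) ⁅ B₀ ⁆)
                     (trans (cong (𝟙 (⁅ p₀ ⁆ p) *_) (count-⁅⁆ B₀)) (*-identityʳ _))
      column₀ : ∀ B → count (λ p → ⁅ p₀ ⁆ p ∧ ⁅ B₀ ⁆ B) ≤ 1
      column₀ B = begin
        count (λ p → ⁅ p₀ ⁆ p ∧ ⁅ B₀ ⁆ B) ≤⟨ count-mono (λ p → proj₁ ∘ ∧-true {⁅ p₀ ⁆ p}) ⟩
        count ⁅ p₀ ⁆                      ≡⟨ count-⁅⁆ p₀ ⟩
        1                                 ∎
        where open ≤-Reasoning

    IsMatching-cong : ∀ {G X Y M} → (∀ p → X p ≡ Y p) → IsMatching G X M → IsMatching G Y M
    IsMatching-cong X≗Y m = record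
      { edge = edge m ; row = λ p → trans (row m p) (cong 𝟙 (X≗Y p)) ; column = column m }

    IsMatching-sub : ∀ {G G′ X M} → (∀ p B → G′ p B ≡ true → G p B ≡ true) →
      IsMatching G′ X M → IsMatching G X M
    IsMatching-sub G′⊆G m = record
      { edge = λ p B → G′⊆G p B ∘ edge m p B ; row = row m ; column = column m }

    ∪-matching : ∀ {G X₁ X₂ M₁ M₂} (C : Fin b → Bool) →
      IsMatching G X₁ M₁ → IsMatching G X₂ M₂ → (∀ p → X₁ p ≡ true → X₂ p ≡ false) →
      (∀ p B → M₁ p B ≡ true → C B ≡ true) → (∀ p B → M₂ p B ≡ true → C B ≡ false) →
      IsMatching G (X₁ ∪ X₂) (λ p → M₁ p ∪ M₂ p)
    ∪-matching {G} {X₁} {X₂} {M₁} {M₂} C m₁ m₂ disjoint M₁⊆C M₂⊆∁C =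
      record { edge = edge′ ; row = row′ ; column = column′ }
      where
      edge′ : ∀ p B → M₁ p B ∨ M₂ p B ≡ true → G p B ≡ true
      edge′ p B M₁∨M₂ with M₁ p B in M₁pB
      ... | true  = edge m₁ p B M₁pB
      ... | false = edge m₂ p B M₁∨M₂
      row′ : ∀ p → count (M₁ p ∪ M₂ p) ≡ 𝟙 (X₁ p ∨ X₂ p)
      row′ p with X₁ p in X₁p
      ... | true  = trans (count-cong (λ B → trans (cong (M₁ p B ∨_) (unmatched m₂ p (disjoint p X₁p) B)) (∨-identityʳ _)))
                          (trans (row m₁ p) (cong 𝟙 X₁p))
      ... | false = trans (count-cong (λ B → cong (_∨ M₂ p B) (unmatched m₁ p X₁p B))) (row m₂ p)
      column′ : ∀ B → count (λ p → M₁ p B ∨ M₂ p B) ≤ 1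
      column′ B with C B in CB
      ... | true  = ≤-trans (≤-reflexive (count-cong λ p → trans (cong (M₁ p B ∨_) (M₂-off p)) (∨-identityʳ _)))
                            (column m₁ B)
        where
        M₂-off : ∀ p → M₂ p B ≡ false
        M₂-off p with M₂ p B in M₂pB
        ... | false = refl
        ... | true  = contradiction (trans (sym CB) (M₂⊆∁C p B M₂pB)) λ ()
      ... | false = ≤-trans (≤-reflexive (count-cong λ p → cong (_∨ M₂ p B) (M₁-off p))) (column m₂ B)
        where
        M₁-off : ∀ p → M₁ p B ≡ false
        M₁-off p with M₁ p B in M₁pB
        ... | false = refl
        ... | true  = contradiction (trans (sym (M₁⊆C p B M₁pB)) CB) λ ()

    Critical : (Fin v → Fin b → Bool) → (Fin v → Bool) → (Fin v → Bool) → Set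
    Critical G X W = 0 < count W × count W < count X × count (N G W) ≤ count W

    Critical-cong : ∀ {G X W W′} → (∀ p → W p ≡ W′ p) → Critical G X W → Critical G X W′
    Critical-cong {G} W≗W′ (|W|>0 , |W|<|X| , |NW|≤|W|) =
      subst (0 <_) |W|≡ |W|>0 , subst (_< _) |W|≡ |W|<|X| , subst₂ _≤_ |NW|≡ |W|≡ |NW|≤|W|
      where
      |W|≡  = count-cong W≗W′
      |NW|≡ = count-cong (λ B → nonempty-cong (λ p → cong (_∧ G p B) (W≗W′ p)))

    critical? : ∀ G X → Dec (∃ λ W → W ⊆ X × Critical G X W)
    critical? G X = map′ from-subset to-subset (anySubset? (λ Z → critical-dec (lookup Z ∩ X)))
      where
      critical-dec : ∀ W → Dec (Critical G X W)
      critical-dec W = (0 <? count W) ×-dec (count W <? count X) ×-dec (count (N G W) ≤? count W)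
      from-subset : (∃ λ Z → Critical G X (lookup Z ∩ X)) → ∃ λ W → W ⊆ X × Critical G X W
      from-subset (Z , critical) = lookup Z ∩ X , (λ p → proj₂ ∘ ∧-true) , critical
      to-subset : (∃ λ W → W ⊆ X × Critical G X W) → ∃ λ Z → Critical G X (lookup Z ∩ X)
      to-subset (W , W⊆X , critical) = tabulate W , Critical-cong tabulate∩X critical
        where
        tabulate∩X : ∀ p → W p ≡ lookup (tabulate W) p ∧ X p
        tabulate∩X p rewrite lookup∘tabulate W p = sym (trans (∧-comm (W p) (X p)) (⊆⇒∩≗ W⊆X p))

    drop-columns : (Fin v → Fin b → Bool) → (Fin b → Bool) → Fin v → Fin b → Bool
    drop-columns G C p B = G p B ∧ not (C B)

    N⊆N[drop-columns]∪ : ∀ G C U → N G U ⊆ N (drop-columns G C) U ∪ C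
    N⊆N[drop-columns]∪ G C U B NUB with C B ≟ true
    ... | yes CB = ∨-introʳ CB
    ... | no ¬CB with N-elim G U B NUB
    ...   | p , Up , Gp = ∨-introˡ (N-intro (drop-columns G C) U p B Up (∧-intro Gp (cong not (¬-not ¬CB))))

    hall-beyond-critical : ∀ {G X W} → HallCondition G X → W ⊆ X → count (N G W) ≤ count W →
      HallCondition (drop-columns G (N G W)) (X ∖ W)
    hall-beyond-critical {G} {X} {W} hall W⊆X |NW|≤|W| U U⊆X∖W =
      +-cancelʳ-≤ (count W) (count U) (count (N G′ U)) (begin
        count U + count W               ≡⟨ count-∪-disjoint U∩W≡∅ ⟨
        count (U ∪ W)                   ≤⟨ hall (U ∪ W) U∪W⊆X ⟩
        count (N G (U ∪ W))             ≤⟨ ⊆∪⇒count≤+ N[U∪W]⊆ ⟩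
        count (N G′ U) + count (N G W)  ≤⟨ +-monoʳ-≤ (count (N G′ U)) |NW|≤|W| ⟩
        count (N G′ U) + count W        ∎)
      where
      open ≤-Reasoning
      G′ : Fin v → Fin b → Bool
      G′ = drop-columns G (N G W)
      U∩W≡∅ : ∀ p → U p ≡ true → W p ≡ false
      U∩W≡∅ p Up = not-true (proj₂ (∧-true (U⊆X∖W p Up)))
      U∪W⊆X : U ∪ W ⊆ X
      U∪W⊆X p U∨W with U p in Up
      ... | true  = proj₁ (∧-true (U⊆X∖W p Up))
      ... | false = W⊆X p U∨W
      N[U∪W]⊆ : N G (U ∪ W) ⊆ N G′ U ∪ N G W
      N[U∪W]⊆ B N[U∪W]B with N-elim G (U ∪ W) B N[U∪W]B
      ... | p , U∨W , Gp with U p in Up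
      ...   | true  = N⊆N[drop-columns]∪ G (N G W) U B (N-intro G U p B Up Gp)
      ...   | false = ∨-introʳ (N-intro G W p B U∨W Gp)

    hall-beyond-surplus : ∀ {G X p₀ B₀} → X p₀ ≡ true →
      (∀ U → U ⊆ X → 0 < count U → count U < count X → count U < count (N G U)) →
      HallCondition (drop-columns G ⁅ B₀ ⁆) (X ∖ ⁅ p₀ ⁆)
    hall-beyond-surplus {G} {X} {p₀} {B₀} Xp₀ surplus U U⊆X∖p₀ with 0 <? count U
    ... | no  |U|≯0 = ≤-trans (≮⇒≥ |U|≯0) z≤n
    ... | yes |U|>0 = +-cancelʳ-≤ 1 (count U) (count (N G₁ U)) (begin
      count U + 1                     ≡⟨ +-comm (count U) 1 ⟩
      suc (count U)                   ≤⟨ surplus U U⊆X |U|>0 |U|<|X| ⟩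
      count (N G U)                   ≤⟨ ⊆∪⇒count≤+ (N⊆N[drop-columns]∪ G ⁅ B₀ ⁆ U) ⟩
      count (N G₁ U) + count ⁅ B₀ ⁆   ≡⟨ cong (count (N G₁ U) +_) (count-⁅⁆ B₀) ⟩
      count (N G₁ U) + 1              ∎)
      where
      open ≤-Reasoning
      G₁ : Fin v → Fin b → Bool
      G₁ = drop-columns G ⁅ B₀ ⁆
      U⊆X : U ⊆ X
      U⊆X p Up = proj₁ (∧-true (U⊆X∖p₀ p Up))
      |U|<|X| : count U < count X
      |U|<|X| = ≤-<-trans (count-mono U⊆X∖p₀) (∈⇒count∖⁅⁆<count X p₀ Xp₀)

    match-via-critical : ∀ {m G X W} →
      (∀ G X → count X ≤ m → HallCondition G X → ∃ (IsMatching G X)) →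
      count X ≤ suc m → HallCondition G X → W ⊆ X → Critical G X W → ∃ (IsMatching G X)
    match-via-critical {m} {G} {X} {W} hall-≤m |X|≤1+m hall W⊆X (|W|>0 , |W|<|X| , |NW|≤|W|) =
      _ , IsMatching-cong (⊆⇒∪∖≗ W⊆X)
            (∪-matching (N G W) (proj₂ inside) (IsMatching-sub (λ p B → proj₁ ∘ ∧-true) (proj₂ outside))
               ∖-disjoint inside⊆NW outside⊆∁NW)
      where
      |X∖W|≤m : count (X ∖ W) ≤ m
      |X∖W|≤m = ≤-pred (begin
        suc (count (X ∖ W))        ≤⟨ +-monoˡ-≤ (count (X ∖ W)) |W|>0 ⟩
        count W + count (X ∖ W)    ≡⟨ count-∖-⊆ W⊆X ⟩
        count X                    ≤⟨ |X|≤1+m ⟩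
        suc m                      ∎)
        where open ≤-Reasoning

      inside : ∃ (IsMatching G W)
      inside = hall-≤m G W (≤-pred (≤-trans |W|<|X| |X|≤1+m)) (λ U U⊆W → hall U (λ p → W⊆X p ∘ U⊆W p))
      outside : ∃ (IsMatching (drop-columns G (N G W)) (X ∖ W))
      outside = hall-≤m (drop-columns G (N G W)) (X ∖ W) |X∖W|≤m (hall-beyond-critical hall W⊆X |NW|≤|W|)

      inside⊆NW : ∀ p B → proj₁ inside p B ≡ true → N G W B ≡ true
      inside⊆NW p B M₁pB = N-intro G W p B (matched (proj₂ inside) p B M₁pB) (edge (proj₂ inside) p B M₁pB)
      outside⊆∁NW : ∀ p B → proj₁ outside p B ≡ true → N G W B ≡ false
      outside⊆∁NW p B M₂pB = not-true (proj₂ (∧-true (edge (proj₂ outside) p B M₂pB)))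

    match-via-edge : ∀ {m G X} →
      (∀ G X → count X ≤ m → HallCondition G X → ∃ (IsMatching G X)) →
      count X ≤ suc m → HallCondition G X → ¬ (∃ λ W → W ⊆ X × Critical G X W) → ∃ (IsMatching G X)
    match-via-edge {m} {G} {X} hall-≤m |X|≤1+m hall ¬critical with nonempty X in neX
    ... | false = _ , empty-matching (empty⇒∉ X neX)
    ... | true  = _ , IsMatching-cong (⊆⇒∪∖≗ ⁅p₀⁆⊆X)
                        (∪-matching ⁅ B₀ ⁆ (single-matching Gp₀B₀)
                           (IsMatching-sub (λ p B → proj₁ ∘ ∧-true) (proj₂ rest))
                           ∖-disjoint (λ p B → proj₂ ∘ ∧-true {⁅ p₀ ⁆ p}) rest⊆∁B₀)
      where
      p₀ : Fin v
      p₀ = proj₁ (nonempty-elim X neX)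
      Xp₀ : X p₀ ≡ true
      Xp₀ = proj₂ (nonempty-elim X neX)
      ⁅p₀⁆⊆X : ⁅ p₀ ⁆ ⊆ X
      ⁅p₀⁆⊆X = ∈⇒⁅⁆⊆ X p₀ Xp₀

      neighbour : ∃ λ B → G p₀ B ≡ true
      neighbour with count>0⇒∃ (N G ⁅ p₀ ⁆)
                       (≤-trans (≤-reflexive (sym (count-⁅⁆ p₀))) (hall ⁅ p₀ ⁆ ⁅p₀⁆⊆X))
      ... | B , N⁅p₀⁆B with N-elim G ⁅ p₀ ⁆ B N⁅p₀⁆B
      ...   | p , p≡p₀ , Gp = B , subst (λ q → G q B ≡ true) (∈⁅⁆⇒≡ {i = p₀} p≡p₀) Gp
      B₀ : Fin b
      B₀ = proj₁ neighbour
      Gp₀B₀ : G p₀ B₀ ≡ true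
      Gp₀B₀ = proj₂ neighbour

      surplus : ∀ U → U ⊆ X → 0 < count U → count U < count X → count U < count (N G U)
      surplus U U⊆X |U|>0 |U|<|X| = ≰⇒> (λ |NU|≤|U| → ¬critical (U , U⊆X , |U|>0 , |U|<|X| , |NU|≤|U|))

      rest : ∃ (IsMatching (drop-columns G ⁅ B₀ ⁆) (X ∖ ⁅ p₀ ⁆))
      rest = hall-≤m (drop-columns G ⁅ B₀ ⁆) (X ∖ ⁅ p₀ ⁆)
               (≤-pred (≤-trans (∈⇒count∖⁅⁆<count X p₀ Xp₀) |X|≤1+m)) (hall-beyond-surplus Xp₀ surplus)

      rest⊆∁B₀ : ∀ p B → proj₁ rest p B ≡ true → ⁅ B₀ ⁆ B ≡ false
      rest⊆∁B₀ p B M₁pB = not-true (proj₂ (∧-true (edge (proj₂ rest) p B M₁pB)))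

    -- Halmos–Vaughan: a critical W ⊆ X is matched into N W and X ∖ W into the other columns;
    -- if there is none, every proper part of X has surplus, so any edge at a point of X extends.
    hall-≤ : ∀ m G X → count X ≤ m → HallCondition G X → ∃ (IsMatching G X)
    hall-≤ zero    G X |X|≤0   _    = _ , empty-matching (count≡0⇒∉ X (n≤0⇒n≡0 |X|≤0))
    hall-≤ (suc m) G X |X|≤1+m hall with critical? G X
    ... | yes (W , W⊆X , critical) = match-via-critical (hall-≤ m) |X|≤1+m hall W⊆X critical
    ... | no  ¬critical            = match-via-edge (hall-≤ m) |X|≤1+m hall ¬critical

    hall : ∀ G X → HallCondition G X → ∃ (IsMatching G X)
    hall G X = hall-≤ (count X) G X ≤-refl

    regular⇒hall : ∀ {G X d} → 0 < d → (∀ p → X p ≡ true → count (G p) ≡ d) →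
      (∀ B → count (λ p → X p ∧ G p B) ≤ d) → HallCondition G X
    regular⇒hall {G} {X} {d} d>0 degree codegree U U⊆X =
      *-cancelʳ-≤ (count U) (count (N G U)) d {{>-nonZero d>0}} (begin
        count U * d                                ≡⟨ cong (_* d) (count≡∑ U) ⟩
        (∑[ p < v ] 𝟙 (U p)) * d                   ≡⟨ *-distribʳ-sum d (𝟙 ∘ U) ⟩
        ∑[ p < v ] (𝟙 (U p) * d)                   ≡⟨ sum-cong-≗ row-count ⟨
        ∑[ p < v ] count (λ B → U p ∧ G p B)       ≡⟨ ∑-count-comm (λ p B → U p ∧ G p B) ⟩
        ∑[ B < b ] count (λ p → U p ∧ G p B)       ≤⟨ ∑-mono-≤ column-count ⟩
        ∑[ B < b ] (𝟙 (N G U B) * d)               ≡⟨ *-distribʳ-sum d (𝟙 ∘ N G U) ⟨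
        (∑[ B < b ] 𝟙 (N G U B)) * d               ≡⟨ cong (_* d) (count≡∑ (N G U)) ⟨
        count (N G U) * d                          ∎)
      where
      open ≤-Reasoning
      row-count : ∀ p → count (λ B → U p ∧ G p B) ≡ 𝟙 (U p) * d
      row-count p with U p in Up
      ... | true  = trans (count-∧ˡ true (G p)) (cong (1 *_) (degree p (U⊆X p Up)))
      ... | false = count-∧ˡ false (G p)
      column-count : ∀ B → count (λ p → U p ∧ G p B) ≤ 𝟙 (N G U B) * d
      column-count B with N G U B in NUB
      ... | true  = begin
        count (λ p → U p ∧ G p B)
          ≤⟨ count-mono (λ p UG → ∧-intro (U⊆X p (proj₁ (∧-true UG))) (proj₂ (∧-true UG))) ⟩
        count (λ p → X p ∧ G p B)   ≤⟨ codegree B ⟩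
        d                           ≡⟨ +-identityʳ d ⟨
        1 * d                       ∎
      ... | false = ≤-reflexive (∉⇒count≡0 (λ p → U p ∧ G p B) (empty⇒∉ _ NUB))

module CauchySchwarz where

  open Counting
  open import Data.Bool using (Bool; true; false)
  open import Data.Fin using (Fin)
  open import Data.Nat
  open import Data.Nat.Properties
  open import Data.Nat.Tactic.RingSolver using (solve-∀)
  open import Data.Product using (∃; _×_; _,_)
  open import Data.Sum using (inj₁; inj₂)
  open import Function using (_∘_)
  open import Relation.Binary.PropositionalEquality

  am-gm-≤ : ∀ {x y} → x ≤ y → ∃ λ d → (2 * x * y + d * d ≡ x * x + y * y) × (d ≡ 0 → x ≡ y)
  am-gm-≤ {x} x≤y with m≤n⇒∃[o]m+o≡n x≤y
  ... | d , refl = d , gap x d , λ { refl → sym (+-identityʳ x) }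
    where
    gap : ∀ x d → 2 * x * (x + d) + d * d ≡ x * x + (x + d) * (x + d)
    gap = solve-∀

  am-gm : ∀ x y → ∃ λ d → (2 * x * y + d * d ≡ x * x + y * y) × (d ≡ 0 → x ≡ y)
  am-gm x y with ≤-total x y
  ... | inj₁ x≤y = am-gm-≤ x≤y
  ... | inj₂ y≤x with am-gm-≤ y≤x
  ...   | d , gap , d≡0⇒y≡x = d , trans (cong (_+ d * d) (swap x y)) (trans gap (+-comm (y * y) (x * x))) , sym ∘ d≡0⇒y≡x
    where
    swap : ∀ x y → 2 * x * y ≡ 2 * y * x
    swap = solve-∀

  2xy≤x²+y² : ∀ x y → 2 * x * y ≤ x * x + y * y
  2xy≤x²+y² x y with am-gm x y
  ... | d , gap , _ = ≤-trans (m≤m+n (2 * x * y) (d * d)) (≤-reflexive gap)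

  2xy≡x²+y²⇒x≡y : ∀ x y → 2 * x * y ≡ x * x + y * y → x ≡ y
  2xy≡x²+y²⇒x≡y x y tight with am-gm x y
  ... | d , gap , d≡0⇒x≡y =
    d≡0⇒x≡y (m*m≡0⇒m≡0 (+-cancelˡ-≡ (2 * x * y) (d * d) 0 (trans gap (trans (sym tight) (sym (+-identityʳ _))))))
    where
    m*m≡0⇒m≡0 : ∀ {m} → m * m ≡ 0 → m ≡ 0
    m*m≡0⇒m≡0 {m} m*m≡0 with m*n≡0⇒m≡0∨n≡0 m m*m≡0
    ... | inj₁ m≡0 = m≡0
    ... | inj₂ m≡0 = m≡0

  module _ {n : ℕ} (f : Fin n → ℕ) (T : Fin n → Bool) (supported : ∀ i → T i ≡ false → f i ≡ 0) where

    private
      bound : Fin n → Fin n → ℕ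
      bound i j = 𝟙 (T j) * (f i * f i) + 𝟙 (T i) * (f j * f j)

      ∑f² : ℕ
      ∑f² = ∑[ i < n ] (f i * f i)

      products≤bound : ∀ i j → 2 * f i * f j ≤ bound i j
      products≤bound i j with T i in Ti | T j in Tj
      ... | true  | true  = subst (2 * f i * f j ≤_)
                              (cong₂ _+_ (sym (*-identityˡ (f i * f i))) (sym (*-identityˡ (f j * f j))))
                              (2xy≤x²+y² (f i) (f j))
      ... | false | _     rewrite supported i Ti = z≤n
      ... | true  | false rewrite supported j Tj = ≤-trans (≤-reflexive (*-zeroʳ (2 * f i))) z≤n

      ∑∑products : ∑[ i < n ] ∑[ j < n ] (2 * f i * f j) ≡ 2 * (sum f * sum f)
      ∑∑products = begin
        ∑[ i < n ] ∑[ j < n ] (2 * f i * f j)   ≡⟨ sum-cong-≗ (λ i → *-distribˡ-sum (2 * f i) f) ⟨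
        ∑[ i < n ] (2 * f i * sum f)            ≡⟨ *-distribʳ-sum (sum f) (λ i → 2 * f i) ⟨
        (∑[ i < n ] (2 * f i)) * sum f          ≡⟨ cong (_* sum f) (*-distribˡ-sum 2 f) ⟨
        2 * sum f * sum f                       ≡⟨ *-assoc 2 (sum f) (sum f) ⟩
        2 * (sum f * sum f)                     ∎
        where open ≡-Reasoning

      ∑∑bound : ∑[ i < n ] ∑[ j < n ] bound i j ≡ 2 * (count T * ∑f²)
      ∑∑bound = begin
        ∑[ i < n ] ∑[ j < n ] bound i j
          ≡⟨ sum-cong-≗ (λ i → ∑-distrib-+ (λ j → 𝟙 (T j) * (f i * f i)) (λ j → 𝟙 (T i) * (f j * f j))) ⟩
        ∑[ i < n ] (∑[ j < n ] (𝟙 (T j) * (f i * f i)) + ∑[ j < n ] (𝟙 (T i) * (f j * f j)))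
          ≡⟨ sum-cong-≗ (λ i → cong₂ _+_ (*-distribʳ-sum (f i * f i) (𝟙 ∘ T))
                                          (*-distribˡ-sum (𝟙 (T i)) (λ j → f j * f j))) ⟨
        ∑[ i < n ] (∑𝟙T * (f i * f i) + 𝟙 (T i) * ∑f²)
          ≡⟨ ∑-distrib-+ (λ i → ∑𝟙T * (f i * f i)) (λ i → 𝟙 (T i) * ∑f²) ⟩
        ∑[ i < n ] (∑𝟙T * (f i * f i)) + ∑[ i < n ] (𝟙 (T i) * ∑f²)
          ≡⟨ cong₂ _+_ (*-distribˡ-sum ∑𝟙T (λ i → f i * f i)) (*-distribʳ-sum ∑f² (𝟙 ∘ T)) ⟨
        ∑𝟙T * ∑f² + ∑𝟙T * ∑f²
          ≡⟨ cong (λ c → c * ∑f² + c * ∑f²) (count≡∑ T) ⟨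
        count T * ∑f² + count T * ∑f²
          ≡⟨ cong (count T * ∑f² +_) (+-identityʳ (count T * ∑f²)) ⟨
        2 * (count T * ∑f²)
          ∎
        where
        open ≡-Reasoning
        ∑𝟙T : ℕ
        ∑𝟙T = ∑[ j < n ] 𝟙 (T j)

    cauchy-schwarz : sum f * sum f ≤ count T * ∑[ i < n ] (f i * f i)
    cauchy-schwarz = *-cancelˡ-≤ 2 (begin
      2 * (sum f * sum f)                       ≡⟨ ∑∑products ⟨
      ∑[ i < n ] ∑[ j < n ] (2 * f i * f j)     ≤⟨ ∑-mono-≤ (λ i → ∑-mono-≤ (products≤bound i)) ⟩
      ∑[ i < n ] ∑[ j < n ] bound i j           ≡⟨ ∑∑bound ⟩
      2 * (count T * ∑f²)                       ∎)
      where open ≤-Reasoning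

    cauchy-schwarz-≡ : sum f * sum f ≡ count T * ∑[ i < n ] (f i * f i) →
      ∀ i j → T i ≡ true → T j ≡ true → f i ≡ f j
    cauchy-schwarz-≡ tight i j Ti Tj = 2xy≡x²+y²⇒x≡y (f i) (f j) (begin
      2 * f i * f j
        ≡⟨ ∑-mono-≤-≡⇒≗ (products≤bound i) (∑-mono-≤-≡⇒≗ (λ i → ∑-mono-≤ (products≤bound i)) ∑∑≡ i) j ⟩
      bound i j                            ≡⟨ cong₂ (λ a c → a * (f i * f i) + c * (f j * f j)) (cong 𝟙 Tj) (cong 𝟙 Ti) ⟩
      1 * (f i * f i) + 1 * (f j * f j)    ≡⟨ cong₂ _+_ (*-identityˡ (f i * f i)) (*-identityˡ (f j * f j)) ⟩
      f i * f i + f j * f j                ∎)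
      where
      open ≡-Reasoning
      ∑∑≡ : ∑[ i < n ] ∑[ j < n ] (2 * f i * f j) ≡ ∑[ i < n ] ∑[ j < n ] bound i j
      ∑∑≡ = trans ∑∑products (trans (cong (2 *_) tight) (sym ∑∑bound))

module Quadratic where

  open import Algebra.Bundles using (AbelianGroup)
  open import Data.Integer using (ℤ; +_; -[1+_]; 0ℤ; _+_; _-_; -_; _*_; _≤_; _<_; _≤?_; +≤+; +<+)
  open import Data.Integer.Base using (nonNegative; positive; >-nonZero)
  open import Data.Integer.Properties
  open import Algebra.Properties.Group (AbelianGroup.group +-0-abelianGroup) using (identityʳ-unique)
  open import Data.Integer.Tactic.RingSolver using (solve-∀)
  open import Data.Nat using (z≤n; s≤s)
  open import Data.Product using (_×_; _,_)
  open import Data.Sum using (_⊎_; inj₁; inj₂)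
  open import Function using (_⇔_; mk⇔)
  open import Relation.Binary.PropositionalEquality
  open import Relation.Nullary using (yes; no; contradiction)

  0≤i*j : ∀ {i j} → 0ℤ ≤ i → 0ℤ ≤ j → 0ℤ ≤ i * j
  0≤i*j {i} {j} 0≤i 0≤j = *-monoʳ-≤-nonNeg j {{nonNegative 0≤j}} 0≤i

  0≤i*i : ∀ i → 0ℤ ≤ i * i
  0≤i*i (+ n)    = 0≤i*j {+ n} {+ n} (+≤+ z≤n) (+≤+ z≤n)
  0≤i*i -[1+ n ] = +≤+ z≤n

  0<i*j : ∀ {i j} → 0ℤ < i → 0ℤ < j → 0ℤ < i * j
  0<i*j {i} {j} 0<i 0<j = *-monoʳ-<-pos j {{positive 0<j}} 0<i

  0<j-i : ∀ {i j} → i < j → 0ℤ < j - i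
  0<j-i {i} {j} i<j = subst (_< j - i) (+-inverseʳ i) (+-monoˡ-< (- i) i<j)

  4*i≡0⇒i≡0 : ∀ {i} → + 4 * i ≡ 0ℤ → i ≡ 0ℤ
  4*i≡0⇒i≡0 {i} 4i≡0 = *-cancelˡ-≡ (+ 4) i 0ℤ (trans 4i≡0 (sym (*-zeroʳ (+ 4))))

  ≤-by-gap : ∀ {x y} d → 0ℤ ≤ d → y ≡ x + d → x ≤ y
  ≤-by-gap {x} d 0≤d refl = i≤i+j x d {{nonNegative 0≤d}}

  <-by-gap : ∀ {x y} d → 0ℤ < d → y ≡ x + d → x < y
  <-by-gap {x} d 0<d refl = subst (_< x + d) (+-identityʳ x) (+-monoʳ-< x 0<d)

  square-mono : ∀ {a b} → 0ℤ ≤ a → a ≤ b → a * a ≤ b * b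
  square-mono {a} {b} 0≤a a≤b =
    ≤-trans (*-monoʳ-≤-nonNeg a {{nonNegative 0≤a}} a≤b) (*-monoˡ-≤-nonNeg b {{nonNegative (≤-trans 0≤a a≤b)}} a≤b)

  square-cancel : ∀ {a b} → 0ℤ ≤ b → a * a ≤ b * b → a ≤ b
  square-cancel {a} {b} 0≤b a²≤b² with a ≤? b
  ... | yes a≤b = a≤b
  ... | no  a≰b = contradiction a²≤b² (<⇒≱ (≤-<-trans
          (*-monoˡ-≤-nonNeg b {{nonNegative 0≤b}} (<⇒≤ b<a))
          (*-monoʳ-<-pos a {{positive (≤-<-trans 0≤b b<a)}} b<a)))
    where
    b<a : b < a
    b<a = ≰⇒> a≰b

  private
    A-split : ∀ R K L G → R * (K - R) ≡ (R * (R + K) - + 2 * L * G) + + 2 * (- (R * R - L * G))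
    A-split = solve-∀

    Δ-split : ∀ R K L → R * R * ((R - K) * (R - K) + + 4 * (R - L)) ≡
      R * (K - R) * (R * (K - R)) + + 4 * (R * R * (R - L))
    Δ-split = solve-∀

    -- R²Δ − A(G)² = 4 (L G (R − L) − e c) with c = R² − L G and e = K R + L − R − L G, which is
    -- L (v − G) in a design.  For c > 0 the two counting bounds give e c ≤ L Y c ≤ L G (R − L);
    -- for c ≤ 0 instead A(G) ≤ R (K − R) and Δ ≥ (R − K)².
    discriminant-gap : ∀ R K L G → R * R * ((R - K) * (R - K) + + 4 * (R - L)) ≡
      (R * (R + K) - + 2 * L * G) * (R * (R + K) - + 2 * L * G) +
      + 4 * (L * (G * (R - L)) - (K * R + L - R - L * G) * (R * R - L * G))
    discriminant-gap = solve-∀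

    covering-gap : ∀ R K L G Y → L * Y ≡ (K * R + L - R - L * G) + ((R + (G + Y) * L) - (K * R + L))
    covering-gap = solve-∀

    uncovered-gap : ∀ R L G Y → G * (R - L) ≡ Y * (R * R - L * G) + ((G * R + G * Y * L) - (Y * R * R + G * L))
    uncovered-gap = solve-∀

    root-gap : ∀ R K L N → (+ 2 * N + R - K) * (+ 2 * N + R - K) ≡
      ((R - K) * (R - K) + + 4 * (R - L)) + + 4 * ((N * N + N * R + L) - (R + K * N))
    root-gap = solve-∀

    root-factor : ∀ R K L N → N * (N + R - K) ≡ (R - L) + ((N * N + N * R + L) - (R + K * N))
    root-factor = solve-∀

    root-split : ∀ R K N → + 2 * N + R - K ≡ (N + R - K) + N
    root-split = solve-∀

    A-at-root : ∀ R K L N G Γ → R * (R + K) - + 2 * L * Γ ≡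
      (R * (+ 2 * N + R - K) + + 2 * L * (G - Γ)) + + 2 * (K * R - (N * R + G * L))
    A-at-root = solve-∀

    square-of-product : ∀ R s → R * R * (s * s) ≡ R * s * (R * s)
    square-of-product = solve-∀

  module _ (R K L : ℤ) where

    A : ℤ → ℤ
    A G = R * (R + K) - + 2 * L * G

    Δℤ : ℤ
    Δℤ = (R - K) * (R - K) + + 4 * (R - L)

    -- For β = R (R + K − √Δ) / (2 L):  β ≤ G ⇔ A G ≤ R √Δ  and  β ≡ G ⇔ A G ≡ R √Δ.
    β≤ β≡ : ℤ → Set
    β≤ G = A G ≤ 0ℤ ⊎ A G * A G ≤ R * R * Δℤ
    β≡ G = 0ℤ ≤ A G × A G * A G ≡ R * R * Δℤ

    module _ {G Y : ℤ} (0≤L : 0ℤ ≤ L) (L≤R : L ≤ R)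
             (covering : K * R + L ≤ R + (G + Y) * L)
             (uncovered : Y * R * R + G * L ≤ G * R + G * Y * L) where

      private
        c e : ℤ
        c = R * R - L * G
        e = K * R + L - R - L * G

        e≤LY : e ≤ L * Y
        e≤LY = ≤-by-gap _ (i≤j⇒0≤j-i covering) (covering-gap R K L G Y)

        Yc≤ : Y * c ≤ G * (R - L)
        Yc≤ = ≤-by-gap _ (i≤j⇒0≤j-i uncovered) (uncovered-gap R L G Y)

        ec≤LYc : 0ℤ ≤ c → e * c ≤ L * Y * c
        ec≤LYc 0≤c = *-monoʳ-≤-nonNeg c {{nonNegative 0≤c}} e≤LY

        LYc≤ : L * Y * c ≤ L * (G * (R - L))
        LYc≤ = subst (_≤ _) (sym (*-assoc L Y c)) (*-monoˡ-≤-nonNeg L {{nonNegative 0≤L}} Yc≤)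

        A≤ : c ≤ 0ℤ → A G ≤ R * (K - R)
        A≤ c≤0 = ≤-by-gap _ (0≤i*j {+ 2} (+≤+ z≤n) (neg-mono-≤ c≤0)) (A-split R K L G)

      β≤-from : β≤ G
      β≤-from with c ≤? 0ℤ | A G ≤? 0ℤ
      ... | _       | yes A≤0 = inj₁ A≤0
      ... | yes c≤0 | no  A≰0 = inj₂ (begin
        A G * A G                       ≤⟨ square-mono (<⇒≤ (≰⇒> A≰0)) (A≤ c≤0) ⟩
        R * (K - R) * (R * (K - R))
          ≤⟨ ≤-by-gap _ (0≤i*j {+ 4} (+≤+ z≤n) (0≤i*j (0≤i*i R) (i≤j⇒0≤j-i L≤R))) (Δ-split R K L) ⟩
        R * R * Δℤ                      ∎)
        where open ≤-Reasoning
      ... | no  c≰0 | no  _   = inj₂ (≤-by-gap _ (0≤i*j {+ 4} (+≤+ z≤n) (i≤j⇒0≤j-i ec≤)) (discriminant-gap R K L G))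
        where
        ec≤ : e * c ≤ L * (G * (R - L))
        ec≤ = ≤-trans (ec≤LYc (<⇒≤ (≰⇒> c≰0))) LYc≤

      β≡⇒tight : 0ℤ < L → L < R → β≡ G →
        (K * R + L ≡ R + (G + Y) * L) × (Y * R * R + G * L ≡ G * R + G * Y * L)
      β≡⇒tight 0<L L<R (0≤A , A²≡R²Δ) with c ≤? 0ℤ
      ... | yes c≤0 = contradiction A²≡R²Δ (<⇒≢ (begin-strict
        A G * A G                     ≤⟨ square-mono 0≤A (A≤ c≤0) ⟩
        R * (K - R) * (R * (K - R))   <⟨ <-by-gap _ 0<4R²[R-L] (Δ-split R K L) ⟩
        R * R * Δℤ                    ∎))
        where
        open ≤-Reasoning
        0<R : 0ℤ < R
        0<R = <-trans 0<L L<R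
        0<4R²[R-L] : 0ℤ < + 4 * (R * R * (R - L))
        0<4R²[R-L] = 0<i*j {+ 4} (+<+ (s≤s z≤n)) (0<i*j (0<i*j 0<R 0<R) (0<j-i L<R))
      ... | no  c≰0 = covering-tight , uncovered-tight
        where
        0<c : 0ℤ < c
        0<c = ≰⇒> c≰0
        gap≡0 : L * (G * (R - L)) - e * c ≡ 0ℤ
        gap≡0 = 4*i≡0⇒i≡0 (identityʳ-unique (A G * A G) _ (trans (sym (discriminant-gap R K L G)) (sym A²≡R²Δ)))
        ec≡ : e * c ≡ L * (G * (R - L))
        ec≡ = sym (i-j≡0⇒i≡j _ _ gap≡0)
        LYc≡ec : L * Y * c ≡ e * c
        LYc≡ec = ≤-antisym (≤-trans LYc≤ (≤-reflexive (sym ec≡))) (ec≤LYc (<⇒≤ 0<c))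
        e≡LY : e ≡ L * Y
        e≡LY = *-cancelʳ-≡ e (L * Y) c {{>-nonZero 0<c}} (sym LYc≡ec)
        Yc≡ : Y * c ≡ G * (R - L)
        Yc≡ = *-cancelˡ-≡ L (Y * c) (G * (R - L)) {{>-nonZero 0<L}} (trans (sym (*-assoc L Y c)) (trans LYc≡ec ec≡))
        covering-tight : K * R + L ≡ R + (G + Y) * L
        covering-tight = sym (i-j≡0⇒i≡j _ _ (identityʳ-unique e _ (trans (sym (covering-gap R K L G Y)) (sym e≡LY))))
        uncovered-tight : Y * R * R + G * L ≡ G * R + G * Y * L
        uncovered-tight = sym (i-j≡0⇒i≡j _ _ (identityʳ-unique (Y * c) _ (trans (sym (uncovered-gap R L G Y)) (sym Yc≡))))

    s : ℤ → ℤ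
    s N = + 2 * N + R - K

    root⇒ : ∀ {N} → N * N + N * R + L ≡ R + K * N → s N * s N ≡ Δℤ
    root⇒ {N} root = begin
      s N * s N                                                 ≡⟨ root-gap R K L N ⟩
      Δℤ + + 4 * ((N * N + N * R + L) - (R + K * N))            ≡⟨ cong (λ d → Δℤ + + 4 * d) (i≡j⇒i-j≡0 root) ⟩
      Δℤ + + 4 * 0ℤ                                             ≡⟨ +-identityʳ Δℤ ⟩
      Δℤ                                                        ∎
      where open ≡-Reasoning

    root⇐ : ∀ N → s N * s N ≡ Δℤ → N * N + N * R + L ≡ R + K * N
    root⇐ N s²≡Δ = i-j≡0⇒i≡j _ _ (4*i≡0⇒i≡0 (identityʳ-unique Δℤ _ (trans (sym (root-gap R K L N)) s²≡Δ)))

    root-nonneg : ∀ {N} → 0ℤ ≤ N → L < R → N * N + N * R + L ≡ R + K * N → 0ℤ ≤ s N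
    root-nonneg {N} 0≤N L<R root with 0ℤ ≤? s N
    ... | yes 0≤s = 0≤s
    ... | no  0≰s = contradiction (0<j-i L<R) (≤⇒≯ (begin
      R - L                                              ≡⟨ +-identityʳ (R - L) ⟨
      (R - L) + 0ℤ                                       ≡⟨ cong (λ d → (R - L) + d) (i≡j⇒i-j≡0 root) ⟨
      (R - L) + ((N * N + N * R + L) - (R + K * N))      ≡⟨ root-factor R K L N ⟨
      N * (N + R - K)                                    ≤⟨ *-monoˡ-≤-nonNeg N {{nonNegative 0≤N}} N+R-K≤0 ⟩
      N * 0ℤ                                             ≡⟨ *-zeroʳ N ⟩
      0ℤ                                                 ∎))
      where
      open ≤-Reasoning
      N+R-K≤0 : N + R - K ≤ 0ℤ
      N+R-K≤0 = ≤-trans (≤-by-gap N 0≤N (root-split R K N)) (<⇒≤ (≰⇒> 0≰s))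

    β≡-at-root : ∀ N G {Γ} → 0ℤ < R → L < R → 0ℤ ≤ L → K * R ≡ N * R + G * L →
      0ℤ ≤ s N → s N * s N ≡ Δℤ → Γ ≤ G → β≤ Γ → β≡ Γ
    β≡-at-root N G {Γ} 0<R L<R 0≤L KR≡ 0≤s s²≡Δ Γ≤G = from-bound
      where
      0≤Rs : 0ℤ ≤ R * s N
      0≤Rs = 0≤i*j (<⇒≤ 0<R) 0≤s
      A≡ : A Γ ≡ R * s N + + 2 * L * (G - Γ)
      A≡ = trans (A-at-root R K L N G Γ)
                 (trans (cong (λ d → R * s N + + 2 * L * (G - Γ) + + 2 * d) (i≡j⇒i-j≡0 KR≡)) (+-identityʳ _))
      Rs≤A : R * s N ≤ A Γ
      Rs≤A = ≤-by-gap _ (0≤i*j (0≤i*j {+ 2} (+≤+ z≤n) 0≤L) (i≤j⇒0≤j-i Γ≤G)) A≡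
      R²Δ≡[Rs]² : R * R * Δℤ ≡ R * s N * (R * s N)
      R²Δ≡[Rs]² = trans (cong (R * R *_) (sym s²≡Δ)) (square-of-product R (s N))
      0<Δ : 0ℤ < Δℤ
      0<Δ = <-≤-trans (0<i*j {+ 4} (+<+ (s≤s z≤n)) (0<j-i L<R))
                      (≤-by-gap _ (0≤i*i (R - K)) (+-comm ((R - K) * (R - K)) (+ 4 * (R - L))))

      from-bound : β≤ Γ → β≡ Γ
      from-bound (inj₁ A≤0) = contradiction R²Δ≡0 (≢-sym (<⇒≢ (0<i*j (0<i*j 0<R 0<R) 0<Δ)))
        where
        Rs≡0 : R * s N ≡ 0ℤ
        Rs≡0 = ≤-antisym (≤-trans Rs≤A A≤0) 0≤Rs
        R²Δ≡0 : R * R * Δℤ ≡ 0ℤ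
        R²Δ≡0 = trans R²Δ≡[Rs]² (cong (λ x → x * x) Rs≡0)
      from-bound (inj₂ A²≤R²Δ) = subst (0ℤ ≤_) (sym A≡Rs) 0≤Rs , trans (cong (λ x → x * x) A≡Rs) (sym R²Δ≡[Rs]²)
        where
        A≡Rs : A Γ ≡ R * s N
        A≡Rs = ≤-antisym (square-cancel 0≤Rs (subst (A Γ * A Γ ≤_) R²Δ≡[Rs]² A²≤R²Δ)) Rs≤A

  private
    A-symmetric : ∀ R L Γ → R * (R + R) - + 2 * L * Γ ≡ + 2 * (R * R - L * Γ)
    A-symmetric = solve-∀

    Δ-symmetric : ∀ R L → (R - R) * (R - R) + + 4 * (R - L) ≡ + 4 * (R - L)
    Δ-symmetric = solve-∀

    s-symmetric : ∀ R N → + 2 * N + R - R ≡ + 2 * N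
    s-symmetric = solve-∀

    square-of-double : ∀ x → + 2 * x * (+ 2 * x) ≡ + 4 * (x * x)
    square-of-double = solve-∀

    R²Δ-symmetric : ∀ R L → R * R * (+ 4 * (R - L)) ≡ + 4 * (R * R * (R - L))
    R²Δ-symmetric = solve-∀

  module _ (R L : ℤ) where

    B : ℤ → ℤ
    B Γ = R * R - L * Γ

    private
      A²≡4B² : ∀ Γ → A R R L Γ * A R R L Γ ≡ + 4 * (B Γ * B Γ)
      A²≡4B² Γ = trans (cong (λ x → x * x) (A-symmetric R L Γ)) (square-of-double (B Γ))

      R²Δ≡ : R * R * Δℤ R R L ≡ + 4 * (R * R * (R - L))
      R²Δ≡ = trans (cong (R * R *_) (Δ-symmetric R L)) (R²Δ-symmetric R L)

    β≤-symmetric : ∀ {Γ} → β≤ R R L Γ → B Γ ≤ 0ℤ ⊎ B Γ * B Γ ≤ R * R * (R - L)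
    β≤-symmetric {Γ} (inj₁ A≤0) =
      inj₁ (*-cancelˡ-≤-pos (B Γ) 0ℤ (+ 2) (subst₂ _≤_ (A-symmetric R L Γ) (sym (*-zeroʳ (+ 2))) A≤0))
    β≤-symmetric {Γ} (inj₂ A²≤R²Δ) =
      inj₂ (*-cancelˡ-≤-pos (B Γ * B Γ) (R * R * (R - L)) (+ 4) (subst₂ _≤_ (A²≡4B² Γ) R²Δ≡ A²≤R²Δ))

    β≡-symmetric : ∀ {Γ} → β≡ R R L Γ ⇔ (0ℤ ≤ B Γ × B Γ * B Γ ≡ R * R * (R - L))
    β≡-symmetric {Γ} = mk⇔
      (λ (0≤A , A²≡R²Δ) →
        *-cancelˡ-≤-pos 0ℤ (B Γ) (+ 2) (subst₂ _≤_ (sym (*-zeroʳ (+ 2))) (A-symmetric R L Γ) 0≤A) ,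
        *-cancelˡ-≡ (+ 4) (B Γ * B Γ) (R * R * (R - L)) (trans (sym (A²≡4B² Γ)) (trans A²≡R²Δ R²Δ≡)))
      (λ (0≤B , B²≡) →
        subst (0ℤ ≤_) (sym (A-symmetric R L Γ)) (0≤i*j {+ 2} (+≤+ z≤n) 0≤B) ,
        trans (A²≡4B² Γ) (trans (cong (+ 4 *_) B²≡) (sym R²Δ≡)))

    root-symmetric : ∀ N → 0ℤ ≤ N → (0ℤ ≤ s R R L N × s R R L N * s R R L N ≡ Δℤ R R L) ⇔ N * N ≡ R - L
    root-symmetric N 0≤N = mk⇔
      (λ (_ , s²≡Δ) → *-cancelˡ-≡ (+ 4) (N * N) (R - L) (trans (sym s²≡4N²) (trans s²≡Δ (Δ-symmetric R L))))
      (λ N²≡ → subst (0ℤ ≤_) (sym (s-symmetric R N)) (0≤i*j {+ 2} (+≤+ z≤n) 0≤N) ,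
               trans s²≡4N² (trans (cong (+ 4 *_) N²≡) (sym (Δ-symmetric R L))))
      where
      s²≡4N² : s R R L N * s R R L N ≡ + 4 * (N * N)
      s²≡4N² = trans (cong (λ x → x * x) (s-symmetric R N)) (square-of-double N)

module ArcArithmetic {r k lam n y g : ℕ} where

  open import Data.Nat
  open import Data.Nat.Properties
  open import Data.Nat.Tactic.RingSolver using (solve)
  open import Data.List using (_∷_; [])
  open import Relation.Binary.PropositionalEquality
  open ≡-Reasoning

  complement-relation : ∀ {v} → k * r + lam ≡ r + v * lam → n * r + lam ≡ r + y * lam →
    g + y ≡ v → k * r ≡ n * r + g * lam
  complement-relation {v} k*r+lam≡r+v*lam arc g+y≡v = +-cancelʳ-≡ lam (k * r) (n * r + g * lam) (begin
    k * r + lam              ≡⟨ k*r+lam≡r+v*lam ⟩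
    r + v * lam              ≡⟨ cong (λ x → r + x * lam) g+y≡v ⟨
    r + (g + y) * lam        ≡⟨ solve (r ∷ lam ∷ y ∷ g ∷ []) ⟩
    r + y * lam + g * lam    ≡⟨ cong (_+ g * lam) arc ⟨
    n * r + lam + g * lam    ≡⟨ solve (r ∷ lam ∷ n ∷ g ∷ []) ⟩
    n * r + g * lam + lam    ∎)

  tight⇒y*r≡g*n : 0 < r → y * r * r + g * lam ≡ g * r + g * y * lam →
    n * r + lam ≡ r + y * lam → y * r ≡ g * n
  tight⇒y*r≡g*n 0<r tight arc = *-cancelʳ-≡ (y * r) (g * n) r {{>-nonZero 0<r}} (+-cancelʳ-≡ (g * lam) _ _ (begin
    y * r * r + g * lam   ≡⟨ tight ⟩
    g * r + g * y * lam   ≡⟨ solve (r ∷ lam ∷ y ∷ g ∷ []) ⟩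
    g * (r + y * lam)     ≡⟨ cong (g *_) arc ⟨
    g * (n * r + lam)     ≡⟨ solve (r ∷ lam ∷ n ∷ g ∷ []) ⟩
    g * n * r + g * lam   ∎))

  root⇒n*k : n * n + n * r + lam ≡ r + k * n → n * r + lam ≡ r + y * lam → n * k ≡ n * n + y * lam
  root⇒n*k root arc = +-cancelˡ-≡ r (n * k) (n * n + y * lam) (begin
    r + n * k                ≡⟨ cong (r +_) (*-comm n k) ⟩
    r + k * n                ≡⟨ root ⟨
    n * n + n * r + lam      ≡⟨ +-assoc (n * n) (n * r) lam ⟩
    n * n + (n * r + lam)    ≡⟨ cong (n * n +_) arc ⟩
    n * n + (r + y * lam)    ≡⟨ solve (r ∷ lam ∷ n ∷ y ∷ []) ⟩
    r + (n * n + y * lam)    ∎)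

  n*k⇒root : n * k ≡ n * n + y * lam → n * r + lam ≡ r + y * lam → n * n + n * r + lam ≡ r + k * n
  n*k⇒root n*k≡ arc = begin
    n * n + n * r + lam      ≡⟨ +-assoc (n * n) (n * r) lam ⟩
    n * n + (n * r + lam)    ≡⟨ cong (n * n +_) arc ⟩
    n * n + (r + y * lam)    ≡⟨ solve (r ∷ lam ∷ n ∷ y ∷ []) ⟩
    r + (n * n + y * lam)    ≡⟨ cong (r +_) n*k≡ ⟨
    r + n * k                ≡⟨ cong (r +_) (*-comm n k) ⟩
    r + k * n                ∎

  size⇒n*k : 0 < r → y * r ≡ g * n → k * r ≡ n * r + g * lam → n * k ≡ n * n + y * lam
  size⇒n*k 0<r y*r≡g*n k*r≡ = *-cancelʳ-≡ (n * k) (n * n + y * lam) r {{>-nonZero 0<r}} (begin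
    n * k * r                ≡⟨ *-assoc n k r ⟩
    n * (k * r)              ≡⟨ cong (n *_) k*r≡ ⟩
    n * (n * r + g * lam)    ≡⟨ solve (r ∷ lam ∷ n ∷ g ∷ []) ⟩
    n * n * r + g * n * lam  ≡⟨ cong (λ x → n * n * r + x * lam) y*r≡g*n ⟨
    n * n * r + y * r * lam  ≡⟨ solve (r ∷ lam ∷ n ∷ y ∷ []) ⟩
    (n * n + y * lam) * r    ∎)

  n*k⇒size : 0 < lam → k * r ≡ n * r + g * lam → n * k ≡ n * n + y * lam → y * r ≡ n * g
  n*k⇒size 0<lam k*r≡ n*k≡ = *-cancelʳ-≡ (y * r) (n * g) lam {{>-nonZero 0<lam}} (+-cancelˡ-≡ (n * n * r) _ _ (begin
    n * n * r + y * r * lam  ≡⟨ solve (r ∷ lam ∷ n ∷ y ∷ []) ⟩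
    (n * n + y * lam) * r    ≡⟨ cong (_* r) n*k≡ ⟨
    n * k * r                ≡⟨ *-assoc n k r ⟩
    n * (k * r)              ≡⟨ cong (n *_) k*r≡ ⟩
    n * (n * r + g * lam)    ≡⟨ solve (r ∷ lam ∷ n ∷ g ∷ []) ⟩
    n * n * r + n * g * lam  ∎))

  n*k⇒degree : ∀ {d} → n + d ≡ k → n * k ≡ n * n + y * lam → y * lam ≡ n * d
  n*k⇒degree {d} n+d≡k n*k≡ = sym (+-cancelˡ-≡ (n * n) (n * d) (y * lam) (begin
    n * n + n * d            ≡⟨ *-distribˡ-+ n n d ⟨
    n * (n + d)              ≡⟨ cong (n *_) n+d≡k ⟩
    n * k                    ≡⟨ n*k≡ ⟩
    n * n + y * lam          ∎))

module Design {v b k r lam : ℕ} {inc : Fin v → Fin b → Bool} (D : IsDesign v b k r lam inc) where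

  open Counting
  open CauchySchwarz using (cauchy-schwarz; cauchy-schwarz-≡)
  open Hall using (IsMatching; hall; regular⇒hall)
  open import Data.Bool using (Bool; true; false; _∧_; not)
  open import Data.Bool.Properties using (∧-zeroʳ; ∧-comm)
  open import Data.Fin using (Fin; zero; suc)
  open import Data.Nat
  open import Data.Nat.Properties
  open import Data.Nat.Tactic.RingSolver using (solve-∀)
  open import Data.Product using (∃; _×_; _,_; proj₁; proj₂)
  open import Data.Sum using (_⊎_; inj₁; inj₂)
  open import Function using (_∘_)
  open import Relation.Binary.PropositionalEquality
  open import Relation.Nullary using (yes; no; contradiction)

  open IsDesign D

  meet : (Fin v → Bool) → Fin b → ℕ
  meet Y B = count (λ p → Y p ∧ inc p B)

  ∑-meet : ∀ Y → ∑[ B < b ] meet Y B ≡ count Y * r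
  ∑-meet Y = begin
    ∑[ B < b ] count (λ p → Y p ∧ inc p B)   ≡⟨ ∑-count-comm (λ p B → Y p ∧ inc p B) ⟨
    ∑[ p < v ] count (λ B → Y p ∧ inc p B)
      ≡⟨ sum-cong-≗ (λ p → trans (count-∧ˡ (Y p) (inc p)) (cong (𝟙 (Y p) *_) (replication p))) ⟩
    ∑[ p < v ] (𝟙 (Y p) * r)                 ≡⟨ *-distribʳ-sum r (𝟙 ∘ Y) ⟨
    (∑[ p < v ] 𝟙 (Y p)) * r                 ≡⟨ cong (_* r) (count≡∑ Y) ⟨
    count Y * r                              ∎
    where open ≡-Reasoning

  flags-through : ∀ Y p →
    ∑[ B < b ] (𝟙 (inc p B) * meet Y B) + 𝟙 (Y p) * lam ≡ count Y * lam + 𝟙 (Y p) * r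
  flags-through Y p = begin
    ∑[ B < b ] (𝟙 (inc p B) * meet Y B) + 𝟙 (Y p) * lam
      ≡⟨ cong (_+ 𝟙 (Y p) * lam) flags≡ ⟩
    ∑[ q < v ] (𝟙 (Y q) * pairs q) + 𝟙 (Y p) * lam
      ≡⟨ ∑-except p (λ q q≢p → cong (𝟙 (Y q) *_) (balance p q (q≢p ∘ sym))) ⟩
    ∑[ q < v ] (𝟙 (Y q) * lam) + 𝟙 (Y p) * pairs p
      ≡⟨ cong₂ _+_ (*-distribʳ-sum lam (𝟙 ∘ Y)) (cong (𝟙 (Y p) *_) (sym pairs-diagonal)) ⟨
    (∑[ q < v ] 𝟙 (Y q)) * lam + 𝟙 (Y p) * r
      ≡⟨ cong (λ y → y * lam + 𝟙 (Y p) * r) (count≡∑ Y) ⟨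
    count Y * lam + 𝟙 (Y p) * r
      ∎
    where
    open ≡-Reasoning
    pairs : Fin v → ℕ
    pairs q = count (λ B → inc p B ∧ inc q B)
    pairs-diagonal : pairs p ≡ r
    pairs-diagonal = trans (count-cong (λ B → ∧-idem (inc p B))) (replication p)
      where
      ∧-idem : ∀ a → a ∧ a ≡ a
      ∧-idem true  = refl
      ∧-idem false = refl
    swap : ∀ a y c → a ∧ (y ∧ c) ≡ y ∧ (a ∧ c)
    swap true  y c = refl
    swap false y c = sym (∧-zeroʳ y)
    flags≡ : ∑[ B < b ] (𝟙 (inc p B) * meet Y B) ≡ ∑[ q < v ] (𝟙 (Y q) * pairs q)
    flags≡ = begin
      ∑[ B < b ] (𝟙 (inc p B) * meet Y B)
        ≡⟨ sum-cong-≗ (λ B → count-∧ˡ (inc p B) (λ q → Y q ∧ inc q B)) ⟨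
      ∑[ B < b ] count (λ q → inc p B ∧ (Y q ∧ inc q B))
        ≡⟨ ∑-count-comm (λ B q → inc p B ∧ (Y q ∧ inc q B)) ⟩
      ∑[ q < v ] count (λ B → inc p B ∧ (Y q ∧ inc q B))
        ≡⟨ sum-cong-≗ (λ q → trans (count-cong (λ B → swap (inc p B) (Y q) (inc q B)))
                                   (count-∧ˡ (Y q) (λ B → inc p B ∧ inc q B))) ⟩
      ∑[ q < v ] (𝟙 (Y q) * pairs q)
        ∎

  ∑-meet² : ∀ Y → ∑[ B < b ] (meet Y B * meet Y B) + count Y * lam ≡ count Y * r + count Y * count Y * lam
  ∑-meet² Y = begin
    ∑[ B < b ] (meet Y B * meet Y B) + count Y * lam
      ≡⟨ cong₂ _+_ squares (trans (cong (_* lam) (count≡∑ Y)) (*-distribʳ-sum lam (𝟙 ∘ Y))) ⟩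
    ∑[ q < v ] (𝟙 (Y q) * F q) + ∑[ q < v ] (𝟙 (Y q) * lam)
      ≡⟨ ∑-distrib-+ (λ q → 𝟙 (Y q) * F q) (λ q → 𝟙 (Y q) * lam) ⟨
    ∑[ q < v ] (𝟙 (Y q) * F q + 𝟙 (Y q) * lam)
      ≡⟨ sum-cong-≗ member ⟩
    ∑[ q < v ] (𝟙 (Y q) * (count Y * lam + r))
      ≡⟨ *-distribʳ-sum (count Y * lam + r) (𝟙 ∘ Y) ⟨
    (∑[ q < v ] 𝟙 (Y q)) * (count Y * lam + r)
      ≡⟨ cong (_* (count Y * lam + r)) (count≡∑ Y) ⟨
    count Y * (count Y * lam + r)
      ≡⟨ expand (count Y) lam r ⟩
    count Y * r + count Y * count Y * lam
      ∎
    where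
    open ≡-Reasoning
    expand : ∀ y l r → y * (y * l + r) ≡ y * r + y * y * l
    expand = solve-∀
    F : Fin v → ℕ
    F q = ∑[ B < b ] (𝟙 (inc q B) * meet Y B)
    squares : ∑[ B < b ] (meet Y B * meet Y B) ≡ ∑[ q < v ] (𝟙 (Y q) * F q)
    squares = begin
      ∑[ B < b ] (meet Y B * meet Y B)
        ≡⟨ sum-cong-≗ (λ B → trans (cong (_* meet Y B) (count≡∑ (λ q → Y q ∧ inc q B)))
                                   (*-distribʳ-sum (meet Y B) (λ q → 𝟙 (Y q ∧ inc q B)))) ⟩
      ∑[ B < b ] ∑[ q < v ] (𝟙 (Y q ∧ inc q B) * meet Y B)
        ≡⟨ ∑-comm (λ B q → 𝟙 (Y q ∧ inc q B) * meet Y B) ⟩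
      ∑[ q < v ] ∑[ B < b ] (𝟙 (Y q ∧ inc q B) * meet Y B)
        ≡⟨ sum-cong-≗ (λ q → trans (sum-cong-≗ (λ B → trans (cong (_* meet Y B) (𝟙-∧ (Y q) (inc q B)))
                                                        (*-assoc (𝟙 (Y q)) (𝟙 (inc q B)) (meet Y B))))
                                   (sym (*-distribˡ-sum (𝟙 (Y q)) (λ B → 𝟙 (inc q B) * meet Y B)))) ⟩
      ∑[ q < v ] (𝟙 (Y q) * F q)
        ∎
    member : ∀ q → 𝟙 (Y q) * F q + 𝟙 (Y q) * lam ≡ 𝟙 (Y q) * (count Y * lam + r)
    member q with Y q | flags-through Y q
    ... | false | _       = refl
    ... | true  | through = begin
      1 * F q + 1 * lam              ≡⟨ cong (_+ 1 * lam) (*-identityˡ (F q)) ⟩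
      F q + 1 * lam                  ≡⟨ through ⟩
      count Y * lam + 1 * r          ≡⟨ cong (count Y * lam +_) (*-identityˡ r) ⟩
      count Y * lam + r              ≡⟨ *-identityˡ (count Y * lam + r) ⟨
      1 * (count Y * lam + r)        ∎

  arc-relation : ∀ {Y n} → (∀ B → meet Y B ≡ 0 ⊎ meet Y B ≡ n) → 0 < count Y →
    n * r + lam ≡ r + count Y * lam
  arc-relation {Y} {n} arc 0<y = *-cancelˡ-≡ (n * r + lam) (r + count Y * lam) (count Y) {{>-nonZero 0<y}} (begin
    count Y * (n * r + lam)                  ≡⟨ expand (count Y) n r lam ⟩
    n * (count Y * r) + count Y * lam        ≡⟨ cong (λ x → n * x + count Y * lam) (∑-meet Y) ⟨
    n * ∑[ B < b ] meet Y B + count Y * lam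
      ≡⟨ cong (_+ count Y * lam) (trans (*-distribˡ-sum n (meet Y)) (sum-cong-≗ (sym ∘ square))) ⟩
    ∑[ B < b ] (meet Y B * meet Y B) + count Y * lam  ≡⟨ ∑-meet² Y ⟩
    count Y * r + count Y * count Y * lam    ≡⟨ factor (count Y) r lam ⟩
    count Y * (r + count Y * lam)            ∎)
    where
    open ≡-Reasoning
    expand : ∀ y n r l → y * (n * r + l) ≡ n * (y * r) + y * l
    expand = solve-∀
    factor : ∀ y r l → y * r + y * y * l ≡ y * (r + y * l)
    factor = solve-∀
    square : ∀ B → meet Y B * meet Y B ≡ n * meet Y B
    square B with arc B
    ... | inj₁ m≡0 rewrite m≡0 = sym (*-zeroʳ n)
    ... | inj₂ m≡n rewrite m≡n = refl

  k*r+lam≡r+v*lam : 0 < v → k * r + lam ≡ r + v * lam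
  k*r+lam≡r+v*lam 0<v = subst (λ y → k * r + lam ≡ r + y * lam) (count-full v)
    (arc-relation {Y = λ _ → true} (λ B → inj₂ (block-size B)) (subst (0 <_) (sym (count-full v)) 0<v))

  b*k≡v*r : b * k ≡ v * r
  b*k≡v*r = begin
    b * k                          ≡⟨ ∑-const b k ⟨
    ∑[ B < b ] k                   ≡⟨ sum-cong-≗ (sym ∘ block-size) ⟩
    ∑[ B < b ] meet (λ _ → true) B ≡⟨ ∑-meet (λ _ → true) ⟩
    count {v} (λ _ → true) * r     ≡⟨ cong (_* r) (count-full v) ⟩
    v * r                          ∎
    where open ≡-Reasoning

  lam≤r : ∀ (p q : Fin v) → p ≢ q → lam ≤ r
  lam≤r p q p≢q = begin
    lam                             ≡⟨ balance p q p≢q ⟨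
    count (λ B → inc p B ∧ inc q B) ≤⟨ count-mono (λ B → proj₁ ∘ ∧-true {inc p B}) ⟩
    count (inc p)                   ≡⟨ replication p ⟩
    r                               ∎
    where open ≤-Reasoning

  module NonDegenerate (2≤v : 2 ≤ v) (k<v : k < v) where

    0<v : 0 < v
    0<v = <-trans (s≤s z≤n) 2≤v

    lam<r : lam < r
    lam<r with distinct-points 2≤v
    ... | p , q , p≢q = ≤∧≢⇒< (lam≤r p q p≢q) lam≢r
      where
      lam≢r : lam ≢ r
      lam≢r lam≡r = <⇒≢ k<v (*-cancelʳ-≡ k v lam {{>-nonZero lam-pos}} (+-cancelʳ-≡ lam (k * lam) (v * lam)
        (trans (subst (λ l → k * l + lam ≡ l + v * lam) (sym lam≡r) (k*r+lam≡r+v*lam 0<v)) (+-comm lam (v * lam)))))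

    0<r : 0 < r
    0<r = <-trans lam-pos lam<r

    block-through : ∀ p → ∃ λ B → inc p B ≡ true
    block-through p = count>0⇒∃ (inc p) (subst (0 <_) (sym (replication p)) 0<r)

    b≡v⇒k≡r : b ≡ v → k ≡ r
    b≡v⇒k≡r b≡v = *-cancelˡ-≡ k r v {{>-nonZero 0<v}} (trans (cong (_* k) (sym b≡v)) b*k≡v*r)

    module EdgeDominating {Γ : Fin v → Fin b → Bool} (Γ-dominating : IsEdgeDominatingSet inc Γ) where

      covered : Fin v → Bool
      covered p = nonempty (Γ p)

      covered-block : Fin b → Bool
      covered-block B = nonempty (λ p → Γ p B)

      count-covered≤ : count covered ≤ edgeCount Γ
      count-covered≤ = begin
        count covered                 ≡⟨ count≡∑ covered ⟩
        ∑[ p < v ] 𝟙 (covered p)      ≤⟨ ∑-mono-≤ (λ p → 𝟙-nonempty≤count (Γ p)) ⟩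
        ∑[ p < v ] count (Γ p)        ≡⟨ edgeCount≡∑ Γ ⟨
        edgeCount Γ                   ∎
        where open ≤-Reasoning

      count-covered-block≤ : count covered-block ≤ edgeCount Γ
      count-covered-block≤ = begin
        count covered-block               ≡⟨ count≡∑ covered-block ⟩
        ∑[ B < b ] 𝟙 (covered-block B)    ≤⟨ ∑-mono-≤ (λ B → 𝟙-nonempty≤count (λ p → Γ p B)) ⟩
        ∑[ B < b ] count (λ p → Γ p B)    ≡⟨ ∑-count-comm Γ ⟨
        ∑[ p < v ] count (Γ p)            ≡⟨ edgeCount≡∑ Γ ⟨
        edgeCount Γ                       ∎
        where open ≤-Reasoning

      covering-bound : k * r + lam ≤ r + (edgeCount Γ + count (∁ covered)) * lam
      covering-bound = begin
        k * r + lam                                      ≡⟨ k*r+lam≡r+v*lam 0<v ⟩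
        r + v * lam                                      ≡⟨ cong (λ n → r + n * lam) (count-∁ covered) ⟨
        r + (count covered + count (∁ covered)) * lam    ≤⟨ +-monoʳ-≤ r (*-monoˡ-≤ lam (+-monoˡ-≤ _ count-covered≤)) ⟩
        r + (edgeCount Γ + count (∁ covered)) * lam      ∎
        where open ≤-Reasoning

      uncovered-meets-covered : ∀ B → covered-block B ≡ false → meet (∁ covered) B ≡ 0
      uncovered-meets-covered B uncovered-block = ∉⇒count≡0 _ uncovered-incidence
        where
        uncovered-incidence : ∀ p → not (covered p) ∧ inc p B ≡ false
        uncovered-incidence p with not (covered p) ∧ inc p B in p∉∧p∈B
        ... | false = refl
        ... | true with ∧-true {not (covered p)} p∉∧p∈B
        ...   | uncovered-p , p∈B with proj₂ Γ-dominating p B p∈B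
        ...     | p′ , B′ , Γp′B′ , inj₁ refl =
          contradiction (trans (sym (nonempty-intro (Γ p′) B′ Γp′B′)) (not-true uncovered-p)) λ ()
        ...     | p′ , B′ , Γp′B′ , inj₂ refl =
          contradiction (trans (sym (nonempty-intro (λ q → Γ q B′) p′ Γp′B′)) uncovered-block) λ ()

      private
        y g : ℕ
        y = count (∁ covered)
        g = edgeCount Γ

        m : Fin b → ℕ
        m = meet (∁ covered)

        ∑m² : ℕ
        ∑m² = ∑[ B < b ] (m B * m B)

        cs : sum m * sum m ≤ count covered-block * ∑m²
        cs = cauchy-schwarz m covered-block uncovered-meets-covered

        y·lhs≡ : y * (y * r * r + g * lam) ≡ sum m * sum m + g * y * lam
        y·lhs≡ = trans (expand y r g lam) (cong (λ s → s * s + g * y * lam) (sym (∑-meet (∁ covered))))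
          where
          expand : ∀ y r g l → y * (y * r * r + g * l) ≡ y * r * (y * r) + g * y * l
          expand = solve-∀

        t∑m²≤y·rhs : count covered-block * ∑m² + g * y * lam ≤ y * (g * r + g * y * lam)
        t∑m²≤y·rhs = begin
          count covered-block * ∑m² + g * y * lam   ≤⟨ +-monoˡ-≤ (g * y * lam) (*-monoˡ-≤ ∑m² count-covered-block≤) ⟩
          g * ∑m² + g * y * lam                     ≡⟨ factor g ∑m² y lam ⟩
          g * (∑m² + y * lam)                       ≡⟨ cong (g *_) (∑-meet² (∁ covered)) ⟩
          g * (y * r + y * y * lam)                 ≡⟨ regroup g y r lam ⟩
          y * (g * r + g * y * lam)                 ∎
          where
          open ≤-Reasoning
          factor : ∀ g s y l → g * s + g * y * l ≡ g * (s + y * l)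
          factor = solve-∀
          regroup : ∀ g y r l → g * (y * r + y * y * l) ≡ y * (g * r + g * y * l)
          regroup = solve-∀

      -- y r² ≤ g (r + (y − 1) λ), with the λ-term moved across to avoid truncated subtraction.
      uncovered-bound : count (∁ covered) * r * r + edgeCount Γ * lam ≤
                        edgeCount Γ * r + edgeCount Γ * count (∁ covered) * lam
      uncovered-bound with 0 <? y
      ... | yes 0<y = *-cancelˡ-≤ y {{>-nonZero 0<y}} (begin
        y * (y * r * r + g * lam)       ≡⟨ y·lhs≡ ⟩
        sum m * sum m + g * y * lam     ≤⟨ +-monoˡ-≤ (g * y * lam) cs ⟩
        count covered-block * ∑m² + g * y * lam ≤⟨ t∑m²≤y·rhs ⟩
        y * (g * r + g * y * lam)       ∎)
        where open ≤-Reasoning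
      ... | no  0≮y = subst (λ y → y * r * r + g * lam ≤ g * r + g * y * lam) (sym (n≤0⇒n≡0 (≮⇒≥ 0≮y)))
        (≤-trans (*-monoʳ-≤ g (<⇒≤ lam<r))
                 (≤-reflexive (sym (trans (cong (λ x → g * r + x * lam) (*-zeroʳ g)) (+-identityʳ (g * r))))))

      uncovered-arc : 0 < count (∁ covered) →
        count (∁ covered) * r * r + edgeCount Γ * lam ≡ edgeCount Γ * r + edgeCount Γ * count (∁ covered) * lam →
        ∃ λ n → IsMaximalArc inc (∁ covered) n
      uncovered-arc 0<y tight = m B₀ , (p₀ , p₀-uncovered) , order
        where
        cs-tight : sum m * sum m ≡ count covered-block * ∑m²
        cs-tight = +-cancelʳ-≡ (g * y * lam) _ _ (≤-antisym (+-monoˡ-≤ (g * y * lam) cs) (begin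
          count covered-block * ∑m² + g * y * lam   ≤⟨ t∑m²≤y·rhs ⟩
          y * (g * r + g * y * lam)                 ≡⟨ cong (y *_) tight ⟨
          y * (y * r * r + g * lam)                 ≡⟨ y·lhs≡ ⟩
          sum m * sum m + g * y * lam               ∎))
          where open ≤-Reasoning
        p₀ : Fin v
        p₀ = proj₁ (count>0⇒∃ (∁ covered) 0<y)
        p₀-uncovered : not (covered p₀) ≡ true
        p₀-uncovered = proj₂ (count>0⇒∃ (∁ covered) 0<y)
        B₀ : Fin b
        B₀ = proj₁ (block-through p₀)
        p₀∈B₀ : inc p₀ B₀ ≡ true
        p₀∈B₀ = proj₂ (block-through p₀)
        B₀-covered : covered-block B₀ ≡ true
        B₀-covered with covered-block B₀ in B₀-cov
        ... | true  = refl
        ... | false = contradiction (uncovered-meets-covered B₀ B₀-cov)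
                                    (>⇒≢ (∈⇒count>0 _ p₀ (∧-intro p₀-uncovered p₀∈B₀)))
        order : ∀ B → m B ≡ 0 ⊎ m B ≡ m B₀
        order B with covered-block B in B-cov
        ... | true  = inj₂ (cauchy-schwarz-≡ m covered-block uncovered-meets-covered cs-tight B B₀ B-cov B₀-covered)
        ... | false = inj₁ (uncovered-meets-covered B B-cov)

    module FromArc {Y : Fin v → Bool} {n : ℕ} (arc : IsMaximalArc inc Y n) (root : n * n + n * r + lam ≡ r + k * n) where

      open ArcArithmetic {r} {k} {lam} {n} {count Y} {count (∁ Y)}

      private
        y g₀ : ℕ
        y  = count Y
        g₀ = count (∁ Y)

        0<y : 0 < y
        0<y = ∈⇒count>0 Y (proj₁ (proj₁ arc)) (proj₂ (proj₁ arc))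

        arc-size : n * r + lam ≡ r + y * lam
        arc-size = arc-relation (proj₂ arc) 0<y

      complement-size : k * r ≡ n * r + count (∁ Y) * lam
      complement-size = complement-relation {v} (k*r+lam≡r+v*lam 0<v) arc-size (trans (+-comm g₀ y) (count-∁ Y))

      private
        n*k≡ : n * k ≡ n * n + y * lam
        n*k≡ = root⇒n*k root arc-size

        T : Fin b → Bool
        T B = nonempty (λ p → Y p ∧ inc p B)

        meet≡n𝟙T : ∀ B → meet Y B ≡ n * 𝟙 (T B)
        meet≡n𝟙T B with T B in TB | proj₂ arc B
        ... | true  | inj₂ meet≡n = trans meet≡n (sym (*-identityʳ n))
        ... | true  | inj₁ meet≡0 = contradiction meet≡0 (>⇒≢ (nonempty⇒count>0 (λ p → Y p ∧ inc p B) TB))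
        ... | false | _           = trans (∉⇒count≡0 _ (empty⇒∉ (λ p → Y p ∧ inc p B) TB)) (sym (*-zeroʳ n))

        p₀ : Fin v
        p₀ = proj₁ (proj₁ arc)

        B₀ : Fin b
        B₀ = proj₁ (block-through p₀)

        0<meet-B₀ : 0 < meet Y B₀
        0<meet-B₀ = ∈⇒count>0 _ p₀ (∧-intro (proj₂ (proj₁ arc)) (proj₂ (block-through p₀)))

        meet-B₀≡n : meet Y B₀ ≡ n
        meet-B₀≡n with proj₂ arc B₀
        ... | inj₁ meet≡0 = contradiction meet≡0 (>⇒≢ 0<meet-B₀)
        ... | inj₂ meet≡n = meet≡n

        0<n : 0 < n
        0<n = subst (0 <_) meet-B₀≡n 0<meet-B₀

        count-T≡g₀ : count T ≡ g₀
        count-T≡g₀ = *-cancelˡ-≡ (count T) g₀ n {{>-nonZero 0<n}} (begin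
          n * count T                  ≡⟨ cong (n *_) (count≡∑ T) ⟩
          n * ∑[ B < b ] 𝟙 (T B)       ≡⟨ *-distribˡ-sum n (𝟙 ∘ T) ⟩
          ∑[ B < b ] (n * 𝟙 (T B))     ≡⟨ sum-cong-≗ meet≡n𝟙T ⟨
          ∑[ B < b ] meet Y B          ≡⟨ ∑-meet Y ⟩
          y * r                        ≡⟨ n*k⇒size lam-pos complement-size n*k≡ ⟩
          n * g₀                       ∎)
          where open ≡-Reasoning

        d : ℕ
        d = k ∸ n

        n+d≡k : n + d ≡ k
        n+d≡k = m+[n∸m]≡n (begin
          n                            ≡⟨ meet-B₀≡n ⟨
          meet Y B₀                    ≤⟨ count-mono (λ p → proj₂ ∘ ∧-true {Y p}) ⟩
          count (λ p → inc p B₀)       ≡⟨ block-size B₀ ⟩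
          k                            ∎)
          where open ≤-Reasoning

        y*lam≡n*d : y * lam ≡ n * d
        y*lam≡n*d = n*k⇒degree n+d≡k n*k≡

        0<d : 0 < d
        0<d with d in d≡
        ... | suc _ = s≤s z≤n
        ... | zero  = contradiction (trans y*lam≡n*d (trans (cong (n *_) d≡) (*-zeroʳ n))) (>⇒≢ (*-mono-< 0<y lam-pos))

        H : Fin v → Fin b → Bool
        H p B = T B ∧ inc p B

        point-degree : ∀ p → not (Y p) ≡ true → count (H p) ≡ d
        point-degree p p∉Y = *-cancelˡ-≡ (count (H p)) d n {{>-nonZero 0<n}} (begin
          n * count (H p)                          ≡⟨ cong (n *_) (count≡∑ (H p)) ⟩
          n * ∑[ B < b ] 𝟙 (H p B)                 ≡⟨ *-distribˡ-sum n (𝟙 ∘ H p) ⟩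
          ∑[ B < b ] (n * 𝟙 (T B ∧ inc p B))       ≡⟨ sum-cong-≗ flag ⟩
          ∑[ B < b ] (𝟙 (inc p B) * meet Y B)      ≡⟨ flags-through-∉ ⟩
          y * lam                                  ≡⟨ y*lam≡n*d ⟩
          n * d                                    ∎)
          where
          open ≡-Reasoning
          rearrange : ∀ n t i → n * (t * i) ≡ i * (n * t)
          rearrange = solve-∀
          flag : ∀ B → n * 𝟙 (T B ∧ inc p B) ≡ 𝟙 (inc p B) * meet Y B
          flag B = trans (cong (n *_) (𝟙-∧ (T B) (inc p B)))
                     (trans (rearrange n (𝟙 (T B)) (𝟙 (inc p B))) (cong (𝟙 (inc p B) *_) (sym (meet≡n𝟙T B))))
          flags-through-∉ : ∑[ B < b ] (𝟙 (inc p B) * meet Y B) ≡ y * lam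
          flags-through-∉ = +-cancelʳ-≡ 0 _ _
            (subst (λ x → ∑[ B < b ] (𝟙 (inc p B) * meet Y B) + 𝟙 x * lam ≡ y * lam + 𝟙 x * r)
                   (not-true p∉Y) (flags-through Y p))

        block-degree : ∀ B → T B ≡ true → count (λ p → not (Y p) ∧ inc p B) ≡ d
        block-degree B TB = +-cancelˡ-≡ n _ d (begin
          n + count (λ p → not (Y p) ∧ inc p B)
            ≡⟨ cong₂ _+_ meet-B≡n (count-cong (λ p → ∧-comm (inc p B) (not (Y p)))) ⟨
          meet Y B + count (λ p → inc p B ∧ not (Y p))
            ≡⟨ cong (_+ count (λ p → inc p B ∧ not (Y p))) (count-cong (λ p → ∧-comm (Y p) (inc p B))) ⟩
          count (λ p → inc p B ∧ Y p) + count (λ p → inc p B ∧ not (Y p))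
            ≡⟨ count-∩-∖ (λ p → inc p B) Y ⟨
          count (λ p → inc p B)
            ≡⟨ block-size B ⟩
          k
            ≡⟨ n+d≡k ⟨
          n + d
            ∎)
          where
          open ≡-Reasoning
          meet-B≡n : meet Y B ≡ n
          meet-B≡n = trans (meet≡n𝟙T B) (trans (cong (λ t → n * 𝟙 t) TB) (*-identityʳ n))

        codegree : ∀ B → count (λ p → ∁ Y p ∧ H p B) ≤ d
        codegree B with T B in TB
        ... | true  = ≤-reflexive (block-degree B TB)
        ... | false = ≤-trans (≤-reflexive (∉⇒count≡0 _ (λ p → ∧-zeroʳ (not (Y p))))) z≤n

      module _ {M : Fin v → Fin b → Bool} (matching : IsMatching H (∁ Y) M) where

        private
          column-full : ∀ B → count (λ p → M p B) ≡ 𝟙 (T B)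
          column-full = ∑-mono-≤-≡⇒≗ column≤ (begin
            ∑[ B < b ] count (λ p → M p B)   ≡⟨ ∑-count-comm M ⟨
            ∑[ p < v ] count (M p)           ≡⟨ sum-cong-≗ (IsMatching.row matching) ⟩
            ∑[ p < v ] 𝟙 (∁ Y p)             ≡⟨ count≡∑ (∁ Y) ⟨
            g₀                               ≡⟨ count-T≡g₀ ⟨
            count T                          ≡⟨ count≡∑ T ⟩
            ∑[ B < b ] 𝟙 (T B)               ∎)
            where
            open ≡-Reasoning
            column≤ : ∀ B → count (λ p → M p B) ≤ 𝟙 (T B)
            column≤ B with T B in TB
            ... | true  = IsMatching.column matching B
            ... | false = ≤-reflexive (∉⇒count≡0 _ M-off)
              where
              M-off : ∀ p → M p B ≡ false
              M-off p with M p B in MpB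
              ... | false = refl
              ... | true  = contradiction (trans (sym TB) (proj₁ (∧-true (IsMatching.edge matching p B MpB)))) λ ()

        matching-dominates : IsEdgeDominatingSet inc M
        matching-dominates = M⊆inc , dominating
          where
          M⊆inc : ∀ p B → M p B ≡ true → inc p B ≡ true
          M⊆inc p B MpB = proj₂ (∧-true {T B} (IsMatching.edge matching p B MpB))
          dominating : ∀ p B → inc p B ≡ true → ∃ λ p′ → ∃ λ B′ → M p′ B′ ≡ true × (p′ ≡ p ⊎ B′ ≡ B)
          dominating p B p∈B with Y p in Yp
          ... | false = let B′ , MpB′ = count>0⇒∃ (M p) (subst (0 <_) (sym row-p) (s≤s z≤n)) in p , B′ , MpB′ , inj₁ refl
            where
            row-p : count (M p) ≡ 1
            row-p = trans (IsMatching.row matching p) (cong (𝟙 ∘ not) Yp)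
          ... | true  = let p′ , Mp′B = count>0⇒∃ (λ q → M q B) (subst (0 <_) (sym column-B) (s≤s z≤n))
                        in p′ , B , Mp′B , inj₂ refl
            where
            column-B : count (λ q → M q B) ≡ 1
            column-B = trans (column-full B) (cong 𝟙 (nonempty-intro (λ q → Y q ∧ inc q B) p (∧-intro Yp p∈B)))

        matching-size : edgeCount M ≡ count (∁ Y)
        matching-size = trans (edgeCount≡∑ M) (trans (sum-cong-≗ (IsMatching.row matching)) (sym (count≡∑ (∁ Y))))

      arc⇒dominating : ∃ λ M → IsEdgeDominatingSet inc M × edgeCount M ≡ count (∁ Y)
      arc⇒dominating = dominating-from (hall H (∁ Y) (regular⇒hall 0<d point-degree codegree))
        where
        dominating-from : ∃ (IsMatching H (∁ Y)) → ∃ λ M → IsEdgeDominatingSet inc M × edgeCount M ≡ count (∁ Y)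
        dominating-from (M , matching) = M , matching-dominates matching , matching-size matching

module DesignBound {v b k r lam : ℕ} {inc : Fin v → Fin b → Bool} (D : IsDesign v b k r lam inc)
                   (2≤v : 2 ℕ.≤ v) (k<v : k ℕ.< v) where

  open Counting using (∁)
  open Quadratic
  open IsDesign D using (lam-pos)
  open Design D
  open NonDegenerate 2≤v k<v
  open import Data.Integer using (ℤ; +_; 0ℤ; _+_; _-_; _*_; _≤_; +≤+; +<+)
  open import Data.Integer.Properties using (pos-*; +-injective)
  import Data.Nat.Properties as ℕ
  open import Data.Nat using (z≤n)
  open import Data.Product using (∃; _×_; _,_; proj₁; proj₂)
  open import Data.Sum using (_⊎_)
  open import Function using (_∘_; _⇔_; mk⇔; Equivalence)
  open import Function.Construct.Composition using (_⇔-∘_)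
  open import Function.Construct.Symmetry using (⇔-sym)
  open import Relation.Binary.PropositionalEquality

  private
    cast-≡ : ∀ {a c A C} → + a ≡ A → + c ≡ C → a ≡ c → A ≡ C
    cast-≡ a≡A c≡C a≡c = trans (sym a≡A) (trans (cong +_ a≡c) c≡C)

    cast-≤ : ∀ {a c A C} → + a ≡ A → + c ≡ C → a ℕ.≤ c → A ≤ C
    cast-≤ a≡A c≡C a≤c = subst₂ _≤_ a≡A c≡C (+≤+ a≤c)

    uncast-≡ : ∀ {a c A C} → + a ≡ A → + c ≡ C → A ≡ C → a ≡ c
    uncast-≡ a≡A c≡C A≡C = +-injective (trans a≡A (trans A≡C (sym c≡C)))

    +[a*b+c] : ∀ a b c → + (a ℕ.* b ℕ.+ c) ≡ + a * + b + + c
    +[a*b+c] a b c = cong (_+ + c) (pos-* a b)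

    +[a+b*c] : ∀ a b c → + (a ℕ.+ b ℕ.* c) ≡ + a + + b * + c
    +[a+b*c] a b c = cong (λ x → + a + x) (pos-* b c)

    +[a*b*c] : ∀ a b c → + (a ℕ.* b ℕ.* c) ≡ + a * + b * + c
    +[a*b*c] a b c = trans (pos-* (a ℕ.* b) c) (cong (_* + c) (pos-* a b))

    +[a*b+c*d] : ∀ a b c d → + (a ℕ.* b ℕ.+ c ℕ.* d) ≡ + a * + b + + c * + d
    +[a*b+c*d] a b c d = cong₂ _+_ (pos-* a b) (pos-* c d)

    +[a*b*c+d*e] : ∀ a b c d e → + (a ℕ.* b ℕ.* c ℕ.+ d ℕ.* e) ≡ + a * + b * + c + + d * + e
    +[a*b*c+d*e] a b c d e = cong₂ _+_ (+[a*b*c] a b c) (pos-* d e)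

    +[a*b+c*d*e] : ∀ a b c d e → + (a ℕ.* b ℕ.+ c ℕ.* d ℕ.* e) ≡ + a * + b + + c * + d * + e
    +[a*b+c*d*e] a b c d e = cong₂ _+_ (pos-* a b) (+[a*b*c] c d e)

  ArcWitness : ℕ → Set
  ArcWitness x = ∃ λ n → 0ℤ ≤ s (+ x) (+ k) (+ lam) (+ n)
                       × s (+ x) (+ k) (+ lam) (+ n) * s (+ x) (+ k) (+ lam) (+ n) ≡ Δℤ (+ x) (+ k) (+ lam)
                       × HasMaximalArc inc n

  module _ {Γ : Fin v → Fin b → Bool} (Γ-dominating : IsEdgeDominatingSet inc Γ) where

    open EdgeDominating Γ-dominating

    private
      g y : ℕ
      g = edgeCount Γ
      y = count (∁ covered)

      covering : + k * + r + + lam ≤ + r + (+ g + + y) * + lam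
      covering = cast-≤ (+[a*b+c] k r lam) (+[a+b*c] r (g ℕ.+ y) lam) covering-bound

      uncovered : + y * + r * + r + + g * + lam ≤ + g * + r + + g * + y * + lam
      uncovered = cast-≤ (+[a*b*c+d*e] y r r g lam) (+[a*b+c*d*e] g r g y lam) uncovered-bound

    lower-bound : β≤ (+ r) (+ k) (+ lam) (+ edgeCount Γ)
    lower-bound = β≤-from (+ r) (+ k) (+ lam) (+≤+ z≤n) (+≤+ (ℕ.<⇒≤ lam<r)) covering uncovered

    attained⇒arc : β≡ (+ r) (+ k) (+ lam) (+ edgeCount Γ) → ArcWitness r
    attained⇒arc β≡g = n , root-nonneg (+ r) (+ k) (+ lam) (+≤+ z≤n) (+<+ lam<r) root-ℤ
                         , root⇒ (+ r) (+ k) (+ lam) root-ℤ , ∁ covered , arc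
      where
      tight : (+ k * + r + + lam ≡ + r + (+ g + + y) * + lam) ×
              (+ y * + r * + r + + g * + lam ≡ + g * + r + + g * + y * + lam)
      tight = β≡⇒tight (+ r) (+ k) (+ lam) (+≤+ z≤n) (+≤+ (ℕ.<⇒≤ lam<r)) covering uncovered
                       (+<+ lam-pos) (+<+ lam<r) β≡g

      covering-tight : k ℕ.* r ℕ.+ lam ≡ r ℕ.+ (g ℕ.+ y) ℕ.* lam
      covering-tight = uncast-≡ (+[a*b+c] k r lam) (+[a+b*c] r (g ℕ.+ y) lam) (proj₁ tight)

      uncovered-tight : y ℕ.* r ℕ.* r ℕ.+ g ℕ.* lam ≡ g ℕ.* r ℕ.+ g ℕ.* y ℕ.* lam
      uncovered-tight = uncast-≡ (+[a*b*c+d*e] y r r g lam) (+[a*b+c*d*e] g r g y lam) (proj₂ tight)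

      g+y≡v : g ℕ.+ y ≡ v
      g+y≡v = ℕ.*-cancelʳ-≡ (g ℕ.+ y) v lam {{ℕ.>-nonZero lam-pos}}
                (ℕ.+-cancelˡ-≡ r _ _ (trans (sym covering-tight) (k*r+lam≡r+v*lam 0<v)))

      0<y : 0 ℕ.< y
      0<y = ℕ.n≢0⇒n>0 y≢0
        where
        y≢0 : y ≢ 0
        y≢0 y≡0 = ℕ.<⇒≢ lam<r (ℕ.*-cancelˡ-≡ lam r g {{ℕ.>-nonZero 0<g}} g*lam≡g*r)
          where
          0<g : 0 ℕ.< g
          0<g = subst (0 ℕ.<_) (trans (sym g+y≡v) (trans (cong (g ℕ.+_) y≡0) (ℕ.+-identityʳ g))) 0<v
          g*lam≡g*r : g ℕ.* lam ≡ g ℕ.* r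
          g*lam≡g*r = trans (subst (λ y → y ℕ.* r ℕ.* r ℕ.+ g ℕ.* lam ≡ g ℕ.* r ℕ.+ g ℕ.* y ℕ.* lam)
                                   y≡0 uncovered-tight)
                            (trans (cong (λ x → g ℕ.* r ℕ.+ x ℕ.* lam) (ℕ.*-zeroʳ g)) (ℕ.+-identityʳ (g ℕ.* r)))

      n : ℕ
      n = proj₁ (uncovered-arc 0<y uncovered-tight)

      arc : IsMaximalArc inc (∁ covered) n
      arc = proj₂ (uncovered-arc 0<y uncovered-tight)

      arc-size : n ℕ.* r ℕ.+ lam ≡ r ℕ.+ y ℕ.* lam
      arc-size = arc-relation (proj₂ arc) 0<y

      open ArcArithmetic {r} {k} {lam} {n} {y} {g}

      root-ℤ : + n * + n + + n * + r + + lam ≡ + r + + k * + n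
      root-ℤ = cast-≡ (cong (_+ + lam) (+[a*b+c*d] n n n r)) (+[a+b*c] r k n)
        (n*k⇒root (size⇒n*k 0<r (tight⇒y*r≡g*n 0<r uncovered-tight arc-size)
                                (complement-relation {v} (k*r+lam≡r+v*lam 0<v) arc-size g+y≡v)) arc-size)

  arc⇒attained : ∀ {γ} → IsEdgeDominationNumber inc γ → ArcWitness r → β≡ (+ r) (+ k) (+ lam) (+ γ)
  arc⇒attained {γ} ((Γ , Γ-dominating , |Γ|≡γ) , minimal) (n , 0≤s , s²≡Δ , Y , arc) =
    β≡-at-root (+ r) (+ k) (+ lam) (+ n) (+ count (∁ Y)) (+<+ 0<r) (+<+ lam<r) (+≤+ z≤n) k*r≡ 0≤s s²≡Δ (+≤+ γ≤|∁Y|)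
      (subst (β≤ (+ r) (+ k) (+ lam) ∘ +_) |Γ|≡γ (lower-bound Γ-dominating))
    where
    root : n ℕ.* n ℕ.+ n ℕ.* r ℕ.+ lam ≡ r ℕ.+ k ℕ.* n
    root = uncast-≡ (cong (_+ + lam) (+[a*b+c*d] n n n r)) (+[a+b*c] r k n) (root⇐ (+ r) (+ k) (+ lam) (+ n) s²≡Δ)

    open FromArc arc root

    γ≤|∁Y| : γ ℕ.≤ count (∁ Y)
    γ≤|∁Y| = bounded-by arc⇒dominating
      where
      bounded-by : (∃ λ M → IsEdgeDominatingSet inc M × edgeCount M ≡ count (∁ Y)) → γ ℕ.≤ count (∁ Y)
      bounded-by (M , M-dominating , |M|≡|∁Y|) = subst (γ ℕ.≤_) |M|≡|∁Y| (minimal M M-dominating)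

    k*r≡ : + k * + r ≡ + n * + r + + count (∁ Y) * + lam
    k*r≡ = cast-≡ (pos-* k r) (+[a*b+c*d] n r (count (∁ Y)) lam) complement-size

  bound-and-equality : ∀ {γ} → IsEdgeDominationNumber inc γ →
    β≤ (+ r) (+ k) (+ lam) (+ γ) × (β≡ (+ r) (+ k) (+ lam) (+ γ) ⇔ ArcWitness r)
  bound-and-equality {γ} γ-min@((Γ , Γ-dominating , |Γ|≡γ) , _) =
    subst (β≤ (+ r) (+ k) (+ lam) ∘ +_) |Γ|≡γ (lower-bound Γ-dominating) ,
    mk⇔ (attained⇒arc Γ-dominating ∘ subst (β≡ (+ r) (+ k) (+ lam) ∘ +_) (sym |Γ|≡γ)) (arc⇒attained γ-min)

  SymmetricArcWitness : Set
  SymmetricArcWitness = ∃ λ n → + n * + n ≡ + k - + lam × HasMaximalArc inc n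

  arc-witness-symmetric : ArcWitness k ⇔ SymmetricArcWitness
  arc-witness-symmetric = mk⇔
    (λ (n , 0≤s , s²≡Δ , arc) → n , Equivalence.to (root-symmetric (+ k) (+ lam) (+ n) (+≤+ z≤n)) (0≤s , s²≡Δ) , arc)
    (λ (n , n²≡k-lam , arc) → let 0≤s , s²≡Δ = Equivalence.from (root-symmetric (+ k) (+ lam) (+ n) (+≤+ z≤n)) n²≡k-lam
                              in n , 0≤s , s²≡Δ , arc)

  symmetric-bound-and-equality : ∀ {γ} → IsEdgeDominationNumber inc γ → b ≡ v →
    (+ k * + k - + lam * + γ ≤ 0ℤ ⊎ (+ k * + k - + lam * + γ) * (+ k * + k - + lam * + γ) ≤ + k * + k * (+ k - + lam)) ×
    ((0ℤ ≤ + k * + k - + lam * + γ × (+ k * + k - + lam * + γ) * (+ k * + k - + lam * + γ) ≡ + k * + k * (+ k - + lam))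
      ⇔ SymmetricArcWitness)
  symmetric-bound-and-equality {γ} γ-min b≡v =
    β≤-symmetric (+ k) (+ lam) (proj₁ at-k) ,
    arc-witness-symmetric ⇔-∘ (proj₂ at-k ⇔-∘ ⇔-sym (β≡-symmetric (+ k) (+ lam) {+ γ}))
    where
    at-k : β≤ (+ k) (+ k) (+ lam) (+ γ) × (β≡ (+ k) (+ k) (+ lam) (+ γ) ⇔ ArcWitness k)
    at-k = subst (λ x → β≤ (+ x) (+ k) (+ lam) (+ γ) × (β≡ (+ x) (+ k) (+ lam) (+ γ) ⇔ ArcWitness x))
                 (sym (b≡v⇒k≡r b≡v)) (bound-and-equality γ-min)

open import Data.Nat using (_≤_; _<_)
open import Data.Product using (_×_; ∃; _,_)
open import Data.Sum using (_⊎_)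
open import Function.Bundles using (_⇔_)
open import Relation.Binary.PropositionalEquality using (_≡_)
open import Data.Integer using (ℤ; +_; _-_; _*_; _+_)
import Data.Integer as Z

corollary3p5 : (v b k r lam : ℕ) (inc : Fin v → Fin b → Bool) →
    2 ≤ v → k < v → IsDesign v b k r lam inc →
    (γ : ℕ) → IsEdgeDominationNumber inc γ →
    ( ( (+ r) * ((+ r) + (+ k)) - (+ 2) * (+ lam) * (+ γ) Z.≤ + 0
        ⊎ ((+ r) * ((+ r) + (+ k)) - (+ 2) * (+ lam) * (+ γ))
            * ((+ r) * ((+ r) + (+ k)) - (+ 2) * (+ lam) * (+ γ))
            Z.≤ (+ r) * (+ r) * Δ k r lam )
    × ( ( + 0 Z.≤ (+ r) * ((+ r) + (+ k)) - (+ 2) * (+ lam) * (+ γ)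
          × ((+ r) * ((+ r) + (+ k)) - (+ 2) * (+ lam) * (+ γ))
              * ((+ r) * ((+ r) + (+ k)) - (+ 2) * (+ lam) * (+ γ))
              ≡ (+ r) * (+ r) * Δ k r lam )
        ⇔ ∃ λ (n : ℕ) → (+ 0 Z.≤ (+ 2) * (+ n) + (+ r) - (+ k))
              × (((+ 2) * (+ n) + (+ r) - (+ k)) * ((+ 2) * (+ n) + (+ r) - (+ k))
                   ≡ Δ k r lam)
              × HasMaximalArc inc n ) )
    × ( b ≡ v →
        ( ( (+ k) * (+ k) - (+ lam) * (+ γ) Z.≤ + 0
            ⊎ ((+ k) * (+ k) - (+ lam) * (+ γ)) * ((+ k) * (+ k) - (+ lam) * (+ γ))
                Z.≤ (+ k) * (+ k) * ((+ k) - (+ lam)) )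
        × ( ( + 0 Z.≤ (+ k) * (+ k) - (+ lam) * (+ γ)
              × ((+ k) * (+ k) - (+ lam) * (+ γ)) * ((+ k) * (+ k) - (+ lam) * (+ γ))
                  ≡ (+ k) * (+ k) * ((+ k) - (+ lam)) )
            ⇔ ∃ λ (n : ℕ) → ((+ n) * (+ n) ≡ (+ k) - (+ lam))
                  × HasMaximalArc inc n ) ) )
corollary3p5 v b k r lam inc 2≤v k<v D γ γ-min =
  bound-and-equality γ-min , symmetric-bound-and-equality γ-min
  where open DesignBound D 2≤v k<v
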